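{- For all integers $i,j\ge 0$ there exists a bijection $$\alpha_{i,j}:\{\beta^{(i,j)}\}\times \mathscr{E}_{2,i}\times \mathscr{E}_{4,j}\to \mathscr{D}^{\mathrm{o}}_{i,j},\qquad (\beta^{(i,j)},\mu,\eta)\mapsto\lambda,$$ such that $|\lambda|=|\beta^{(i,j)}|+|\mu|+|\eta|$, $\ell(\lambda)=\ell(\beta^{(i,j)})$ and $\mathrm{sol}_2(\lambda)=\mathrm{sol}_2(\beta^{(i,j)})$. Further, $$\sum_{\lambda\in \mathscr{D}^{\mathrm{o}}}x^{\mathrm{sol}_2(\lambda)}y^{\ell(\lambda)}q^{|\lambda|}=\sum_{i, j\geq 0}\frac{x^iy^{i+2j}q^{2i^2+4j^2+4ij-i}}{(q^2; q^2)_i(q^4; q^4)_j}.$$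
   Context: A partition $\lambda$ is a finite weakly increasing list of positive integers (its parts); $|\lambda|$ is the sum of parts and $\ell(\lambda)$ the number of parts. $\mathscr{D}^{\mathrm{o}}$ is the set of partitions whose parts are distinct and odd. For $\lambda\in\mathscr{D}^{\mathrm{o}}$, a $2$-sequence of $\lambda$ is a maximal string of parts of $\lambda$ in which consecutive parts differ by exactly $2$; $\mathrm{sol}_2(\lambda)$ is the number of $2$-sequences of $\lambda$ of odd length. For $i,j\ge0$, $\mathscr{D}^{\mathrm{o}}_{i,j}=\{\lambda\in\mathscr{D}^{\mathrm{o}}:\ell(\lambda)=i+2j,\ \mathrm{sol}_2(\lambda)=i\}$. For $k\ge1$, $\mathscr{E}_{k,n}$ is the set of partitions all of whose parts are multiples of $k$ and which have at most $n$ parts. The base partition $\beta^{(i,j)}$ is the partition with parts $1,3,5,7,\dots,4j-3,4j-1$ (i.e. the $2j$ odd numbers $1,3,\dots,4j-1$) together with $4j+1,4j+5,\dots,4j+4i-3$; it satisfies $|\beta^{(i,j)}|=2i^2+4j^2+4ij-i$, $\ell(\beta^{(i,j)})=i+2j$, $\mathrm{sol}_2(\beta^{(i,j)})=i$. $(a;q)_n=\prod_{k=0}^{n-1}(1-aq^k)$. -}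

module Defs where

open import Data.Nat using (ℕ; zero; suc; _+_; _*_; _∸_; _≡ᵇ_; _≤ᵇ_; _<ᵇ_)
open import Data.Nat.Divisibility using (_∣?_)
open import Data.Bool using (Bool; true; false; _∧_; if_then_else_; T)
open import Data.List using (List; []; _∷_; length; map; upTo; _++_)
open import Data.Product using (Σ; _×_)
open import Relation.Nullary.Decidable using (⌊_⌋)
open import Relation.Binary.PropositionalEquality using (_≡_)

-- Partitions are represented as lists of naturals (parts listed in weakly
-- increasing order).  |λ| = sum λ, ℓ(λ) = length λ.

oddᵇ : ℕ → Bool
oddᵇ zero = false
oddᵇ (suc n) = evenᵇ n
  where
  evenᵇ : ℕ → Bool
  evenᵇ zero = true
  evenᵇ (suc m) = oddᵇ m

allᵇ : (ℕ → Bool) → List ℕ → Bool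
allᵇ p [] = true
allᵇ p (x ∷ xs) = p x ∧ allᵇ p xs

nondecᵇ : List ℕ → Bool
nondecᵇ [] = true
nondecᵇ (x ∷ []) = true
nondecᵇ (x ∷ y ∷ ys) = (x ≤ᵇ y) ∧ nondecᵇ (y ∷ ys)

incᵇ : List ℕ → Bool
incᵇ [] = true
incᵇ (x ∷ []) = true
incᵇ (x ∷ y ∷ ys) = (x <ᵇ y) ∧ incᵇ (y ∷ ys)

isPartitionᵇ : List ℕ → Bool
isPartitionᵇ l = allᵇ (λ x → 1 ≤ᵇ x) l ∧ nondecᵇ l

isDoᵇ : List ℕ → Bool
isDoᵇ l = isPartitionᵇ l ∧ (incᵇ l ∧ allᵇ oddᵇ l)

isEᵇ : ℕ → ℕ → List ℕ → Bool
isEᵇ k n l = isPartitionᵇ l ∧ (allᵇ (λ x → ⌊ k ∣? x ⌋) l ∧ (length l ≤ᵇ n))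

-- lengths of the maximal 2-sequences (maximal strings of consecutive parts
-- differing by exactly 2), read left to right
runLengths : List ℕ → List ℕ
runLengths [] = []
runLengths (x ∷ xs) = go x 1 xs
  where
  go : ℕ → ℕ → List ℕ → List ℕ
  go prev len [] = len ∷ []
  go prev len (y ∷ ys) =
    if y ≡ᵇ (prev + 2) then go y (suc len) ys else len ∷ go y 1 ys

sol2 : List ℕ → ℕ
sol2 l = countOdd (runLengths l)
  where
  countOdd : List ℕ → ℕ
  countOdd [] = 0
  countOdd (n ∷ ns) = if oddᵇ n then suc (countOdd ns) else countOdd ns

-- the sets as Σ-types (the predicates are T of a Bool, hence propositions)
𝒟ᵒ : Set
𝒟ᵒ = Σ (List ℕ) (λ l → T (isDoᵇ l))

𝒟ᵒ[_,_] : ℕ → ℕ → Set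
𝒟ᵒ[ i , j ] = Σ (List ℕ) (λ l → T (isDoᵇ l) × (length l ≡ i + 2 * j) × (sol2 l ≡ i))

ℰ[_,_] : ℕ → ℕ → Set
ℰ[ k , n ] = Σ (List ℕ) (λ l → T (isEᵇ k n l))

β : ℕ → ℕ → List ℕ
β i j = map (λ t → 2 * t + 1) (upTo (2 * j)) ++ map (λ t → 4 * j + 1 + 4 * t) (upTo i)

-- Formal power series in q with ℕ coefficients, as coefficient functions.

Series : Set
Series = ℕ → ℕ

sumTo : ℕ → (ℕ → ℕ) → ℕ
sumTo zero f = f 0
sumTo (suc n) f = sumTo n f + f (suc n)

_⊛_ : Series → Series → Series
(f ⊛ g) n = sumTo n (λ t → f t * g (n ∸ t))

one : Series
one zero = 1
one (suc _) = 0

-- 1/(1 - q^m) = Σ_{r ≥ 0} q^{m r}   (used with m ≥ 1)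
geom : ℕ → Series
geom m n = if ⌊ m ∣? n ⌋ then 1 else 0

invPoch : ℕ → ℕ → Series
invPoch k zero = one
invPoch k (suc i) = invPoch k i ⊛ geom (k * suc i)

shift : ℕ → Series → Series
shift e f n = if e ≤ᵇ n then f (n ∸ e) else 0

rhsTerm : ℕ → ℕ → Series
rhsTerm i j = shift (2 * i * i + 4 * j * j + 4 * i * j ∸ i) (invPoch 2 i ⊛ invPoch 4 j)

-- coefficient of x^a y^b q^n in Σ_{i,j≥0} x^i y^{i+2j} rhsTerm i j.
-- Only terms with i = a and i + 2j = b contribute, and these have i, j ≤ b,
-- so the double sum is restricted to 0 ≤ i, j ≤ b without loss.
rhsCoeff : ℕ → ℕ → ℕ → ℕ
rhsCoeff a b n =
  sumTo b (λ i → sumTo b (λ j →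
    if (i ≡ᵇ a) ∧ ((i + 2 * j) ≡ᵇ b) then rhsTerm i j n else 0))

{-# OPTIONS --safe #-}
-- Both sides are sets graded by size and indexed by (i, j), and both satisfy one recursion in
-- which every self-reference strictly raises the size; such a recursion determines its solution up
-- to size-preserving bijection, by induction on the size. An odd distinct partition with i odd
-- 2-sequences and length i + 2j is empty, or starts with 1, 3 (delete both and subtract 4 from the
-- other parts: j drops by one), or starts with a lone 1 (delete it and subtract 4: i drops by one),
-- or has all parts at least 3 (subtract 2 from every part). The products q^|β| ℰ_{2,i} ℰ_{4,j}
-- unfold in the same way, because a partition into at most m multiples of k either has fewer than
-- m parts or has m parts, from each of which k can be subtracted. Counting ℰ_{k,m} by
-- 1/(q^k; q^k)_m then turns the bijection into the generating function identity.
module Submission where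

open import Defs
open import Data.Nat using (ℕ; _+_; _*_)
open import Data.List using (List; length)
open import Data.Nat.ListAction using (sum)
open import Data.Product using (Σ; _×_; _,_; proj₁; proj₂)
open import Data.Bool using (T)
open import Data.Fin using (Fin)
open import Function.Bundles using (_↔_; Inverse)
open import Relation.Binary.PropositionalEquality using (_≡_)

open import Level using (0ℓ) renaming (suc to lsuc)
open import Data.Bool using (Bool; true; false; _∧_; if_then_else_)
open import Data.Bool.Properties using (T-irrelevant; T-∧)
open import Data.Empty using (⊥; ⊥-elim)
import Data.Fin as Fin
open import Data.Fin.Properties using (+↔⊎; *↔×)
open import Data.List using ([]; _∷_; map; replicate; _++_; upTo)
open import Data.List.Properties
  using ( map-∘; map-cong; map-id; map-id-local; map-++; map-applyUpTo
        ; length-map; length-++; length-replicate )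
open import Data.List.Relation.Unary.All using (All; []; _∷_)
import Data.List.Relation.Unary.All as All
open import Data.List.Relation.Unary.All.Properties using (map⁺; map⁻; ++⁺; replicate⁺)
open import Data.List.Relation.Unary.Linked using (Linked; []; [-]; _∷_)
import Data.List.Relation.Unary.Linked as Linked
import Data.List.Relation.Unary.Linked.Properties as Linked
open import Data.List.Relation.Unary.Linked.Properties using (Linked⇒All)
open import Data.Nat using (zero; suc; _∸_; _≤_; _<_; _≤ᵇ_; _<ᵇ_; _≡ᵇ_; _≤?_; ⌊_/2⌋; z≤n; s≤s; NonZero)
open import Data.Nat.Divisibility using (_∣_; _∣?_; divides; _∣0; m∣m*n; ∣m∣n⇒∣m+n; ∣m+n∣m⇒∣n)
open import Data.Nat.DivMod using (_/_; m*[n/m]≡n; m*n/n≡m)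
open import Data.Nat.Induction using (<-rec)
open import Data.Nat.Properties
  using ( +-assoc; +-comm; +-identityʳ; +-suc; +-cancelˡ-≡; +-cancelʳ-≡; +-monoʳ-≤; +-monoʳ-<; +-cancelˡ-<
        ; *-zeroʳ; *-suc; *-comm; *-cancelˡ-≡; m*n≢0; suc-injective
        ; ≤-refl; ≤-reflexive; ≤-trans; <-trans; <-irrefl; <⇒≤; n≤1+n; m≤n⇒m≤1+n; m≤m+n; m≤n+m
        ; m≤n⇒m<n∨m≡n; ≡-irrelevant; ≤-irrelevant; <-irrelevant
        ; m+[n∸m]≡n; m+n∸m≡n; m+n∸n≡m; m∸n+n≡m; n∸n≡0; +-∸-assoc; ∸-monoʳ-<; ∸-monoˡ-≤
        ; ≤⇒≤ᵇ; ≤ᵇ⇒≤; <⇒<ᵇ; <ᵇ⇒<; ≡ᵇ⇒≡; ≡⇒≡ᵇ )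
open import Data.Nat.Tactic.RingSolver using (solve-∀)
open import Data.Product using (curry; uncurry)
import Data.Product.Function.Dependent.Propositional as Σ
open import Data.Product.Function.NonDependent.Propositional using (_×-↔_)
open import Data.Sum using (_⊎_; inj₁; inj₂; [_,_]′)
open import Data.Sum.Function.Propositional using (_⊎-↔_)
open import Data.Unit using (⊤; tt)
open import Function using (_∘_; id; _⟨_⟩_)
open import Function.Bundles using (mk↔ₛ′; _⇔_; mk⇔; Equivalence)
open import Function.Properties.Inverse using (↔-refl; ↔-sym; ↔-trans)
open import Function.Related.Propositional using (module EquationalReasoning)
open import Function.Related.TypeIsomorphisms using (×-distribˡ-⊎; ×-distribʳ-⊎; Σ-distribʳ-⊎; Σ-assoc)
open import Relation.Binary.Bundles using (Setoid)
open import Relation.Binary.Definitions using (Transitive)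
open import Relation.Binary.PropositionalEquality
  using (_≢_; refl; sym; trans; cong; cong₂; subst; module ≡-Reasoning)
import Relation.Binary.Reasoning.Setoid
open import Relation.Nullary using (¬_; Irrelevant; yes; no)
open import Relation.Nullary.Decidable using (⌊_⌋; toWitness; fromWitness)

open Inverse using (to; from; strictlyInverseˡ)

prop-↔ : {A B : Set} → Irrelevant A → Irrelevant B → A ⇔ B → A ↔ B
prop-↔ irrA irrB A⇔B = mk↔ₛ′ (Equivalence.to A⇔B) (Equivalence.from A⇔B)
  (λ _ → irrB _ _) (λ _ → irrA _ _)

×-irrelevant : {A B : Set} → Irrelevant A → Irrelevant B → Irrelevant (A × B)
×-irrelevant irrA irrB (a , b) (a′ , b′) = cong₂ _,_ (irrA a a′) (irrB b b′)

Σ-≡-irrelevant : {A : Set} {P : A → Set} → (∀ {a} → Irrelevant (P a)) →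
                 ∀ {a b} {p : P a} {q : P b} → a ≡ b → (a , p) ≡ (b , q)
Σ-≡-irrelevant irr {p = p} {q} refl = cong (_ ,_) (irr p q)


-- Graded sets

record Graded : Set₁ where
  constructor graded
  field
    Carrier : Set
    size    : Carrier → ℕ
open Graded public

infix 4 _≅_
record _≅_ (A B : Graded) : Set where
  constructor mk≅
  field
    bijection : Carrier A ↔ Carrier B
    size-to   : ∀ a → size B (to bijection a) ≡ size A a
open _≅_ public

infixr 6 _⊕_
infixr 7 _⊗_

_⊕_ : Graded → Graded → Graded
A ⊕ B = graded (Carrier A ⊎ Carrier B) [ size A , size B ]′

_⊗_ : Graded → Graded → Graded
A ⊗ B = graded (Carrier A × Carrier B) (λ (a , b) → size A a + size B b)

raise : ℕ → Graded → Graded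
raise c A = graded (Carrier A) (λ a → c + size A a)

⨁ : (K : Set) → (K → Graded) → Graded
⨁ K X = graded (Σ K (Carrier ∘ X)) (λ (k , x) → size (X k) x)

𝟘 𝟙 : Graded
𝟘 = graded ⊥ λ ()
𝟙 = graded ⊤ λ _ → 0

≅-refl : {A : Graded} → A ≅ A
≅-refl = mk≅ ↔-refl λ _ → refl

≅-sym : {A B : Graded} → A ≅ B → B ≅ A
≅-sym {A} {B} (mk≅ f s) = mk≅ (↔-sym f) λ b →
  trans (sym (s (from f b))) (cong (size B) (strictlyInverseˡ f b))

≅-trans : {A B C : Graded} → A ≅ B → B ≅ C → A ≅ C
≅-trans (mk≅ f s) (mk≅ g t) = mk≅ (↔-trans f g) λ a → trans (t (to f a)) (s a)

≅-setoid : Setoid (lsuc 0ℓ) 0ℓ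
≅-setoid = record
  { Carrier = Graded
  ; _≈_ = _≅_
  ; isEquivalence = record { refl = ≅-refl ; sym = ≅-sym ; trans = ≅-trans }
  }

module ≅-Reasoning = Relation.Binary.Reasoning.Setoid ≅-setoid

⊕-cong : {A B C D : Graded} → A ≅ C → B ≅ D → A ⊕ B ≅ C ⊕ D
⊕-cong (mk≅ f s) (mk≅ g t) = mk≅ (f ⊎-↔ g) λ { (inj₁ a) → s a ; (inj₂ b) → t b }

⊗-cong : {A B C D : Graded} → A ≅ C → B ≅ D → A ⊗ B ≅ C ⊗ D
⊗-cong (mk≅ f s) (mk≅ g t) = mk≅ (f ×-↔ g) λ (a , b) → cong₂ _+_ (s a) (t b)

raise-cong : {A B : Graded} (c : ℕ) → A ≅ B → raise c A ≅ raise c B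
raise-cong c (mk≅ f s) = mk≅ f λ a → cong (c +_) (s a)

raise-≡ : {A : Graded} {c d : ℕ} → c ≡ d → raise c A ≅ raise d A
raise-≡ refl = ≅-refl

raise-+ : {A : Graded} (c d : ℕ) → raise c (raise d A) ≅ raise (c + d) A
raise-+ c d = mk≅ ↔-refl λ a → +-assoc c d _

raise-⊕ : {A B : Graded} (c : ℕ) → raise c (A ⊕ B) ≅ raise c A ⊕ raise c B
raise-⊕ c = mk≅ ↔-refl λ { (inj₁ a) → refl ; (inj₂ b) → refl }

raise-⊗ˡ : {A B : Graded} (c : ℕ) → raise c A ⊗ B ≅ raise c (A ⊗ B)
raise-⊗ˡ {A} {B} c = mk≅ ↔-refl λ (a , b) → sym (+-assoc c (size A a) (size B b))

raise-⊗ʳ : {A B : Graded} (c : ℕ) → A ⊗ raise c B ≅ raise c (A ⊗ B)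
raise-⊗ʳ {A} {B} c = mk≅ ↔-refl λ (a , b) → lemma c (size A a) (size B b)
  where
  lemma : ∀ c x y → c + (x + y) ≡ x + (c + y)
  lemma = solve-∀

⊕-identityˡ : {A : Graded} → 𝟘 ⊕ A ≅ A
⊕-identityˡ = mk≅ (mk↔ₛ′ (λ { (inj₁ ()) ; (inj₂ a) → a }) inj₂ (λ _ → refl)
                          λ { (inj₁ ()) ; (inj₂ a) → refl })
  λ { (inj₁ ()) ; (inj₂ a) → refl }

⊕-identityʳ : {A : Graded} → A ⊕ 𝟘 ≅ A
⊕-identityʳ = mk≅ (mk↔ₛ′ (λ { (inj₁ a) → a ; (inj₂ ()) }) inj₁ (λ _ → refl)
                          λ { (inj₁ a) → refl ; (inj₂ ()) })
  λ { (inj₁ a) → refl ; (inj₂ ()) }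

⊗-identityʳ : {A : Graded} → A ⊗ 𝟙 ≅ A
⊗-identityʳ = mk≅ (mk↔ₛ′ proj₁ (_, tt) (λ _ → refl) λ _ → refl) λ (a , _) → sym (+-identityʳ _)

⊗-distribˡ-⊕ : {A B C : Graded} → A ⊗ (B ⊕ C) ≅ A ⊗ B ⊕ A ⊗ C
⊗-distribˡ-⊕ = mk≅ ×-distribˡ-⊎ λ { (a , inj₁ b) → refl ; (a , inj₂ c) → refl }

⊗-distribʳ-⊕ : {A B C : Graded} → (A ⊕ B) ⊗ C ≅ A ⊗ C ⊕ B ⊗ C
⊗-distribʳ-⊕ = mk≅ ×-distribʳ-⊎ λ { (inj₁ a , c) → refl ; (inj₂ b , c) → refl }

⨁-contract : {K : Set} {X : K → Graded} (k : K) → (∀ k′ → k ≡ k′) → ⨁ K X ≅ X k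
⨁-contract {K} {X} k centre = mk≅ (mk↔ₛ′ t (k ,_) t∘f f∘t) size-t
  where
  t : Carrier (⨁ K X) → Carrier (X k)
  t (k′ , x) with refl ← centre k′ = x
  t∘f : ∀ x → t (k , x) ≡ x
  t∘f x with refl ← centre k = refl
  f∘t : ∀ y → (k , t y) ≡ y
  f∘t (k′ , x) with refl ← centre k′ = refl
  size-t : ∀ y → size (X k) (t y) ≡ size (⨁ K X) y
  size-t (k′ , x) with refl ← centre k′ = refl

⨁-empty : {K : Set} {X : K → Graded} → ¬ K → ⨁ K X ≅ 𝟘
⨁-empty ¬k = mk≅ (mk↔ₛ′ (λ (k , _) → ¬k k) (λ ()) (λ ()) (λ (k , _) → ⊥-elim (¬k k)))
  λ (k , _) → ⊥-elim (¬k k)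

raise-split : {A : Graded} (c d : ℕ) {b : ℕ} → b ≡ c + d → raise b A ≅ raise c (raise d A)
raise-split c d e = ≅-trans (raise-≡ e) (≅-sym (raise-+ c d))

⊗-splitˡ : {A A₀ B : Graded} (a b : ℕ) → A ≅ A₀ ⊕ raise a A →
           raise b (A ⊗ B) ≅ raise b (A₀ ⊗ B) ⊕ raise (a + b) (A ⊗ B)
⊗-splitˡ {A} {A₀} {B} a b A≅ = begin
  raise b (A ⊗ B)                                    ≈⟨ raise-cong b (⊗-cong A≅ ≅-refl) ⟩
  raise b ((A₀ ⊕ raise a A) ⊗ B)                     ≈⟨ raise-cong b ⊗-distribʳ-⊕ ⟩
  raise b (A₀ ⊗ B ⊕ raise a A ⊗ B)                   ≈⟨ raise-⊕ b ⟩
  raise b (A₀ ⊗ B) ⊕ raise b (raise a A ⊗ B)         ≈⟨ ⊕-cong ≅-refl (raise-cong b (raise-⊗ˡ {A} {B} a)) ⟩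
  raise b (A₀ ⊗ B) ⊕ raise b (raise a (A ⊗ B))       ≈⟨ ⊕-cong ≅-refl (raise-split b a (+-comm a b)) ⟨
  raise b (A₀ ⊗ B) ⊕ raise (a + b) (A ⊗ B)           ∎
  where open ≅-Reasoning

⊗-splitʳ : {A B B₀ : Graded} (a b : ℕ) → B ≅ B₀ ⊕ raise a B →
           raise b (A ⊗ B) ≅ raise b (A ⊗ B₀) ⊕ raise (a + b) (A ⊗ B)
⊗-splitʳ {A} {B} {B₀} a b B≅ = begin
  raise b (A ⊗ B)                                    ≈⟨ raise-cong b (⊗-cong ≅-refl B≅) ⟩
  raise b (A ⊗ (B₀ ⊕ raise a B))                     ≈⟨ raise-cong b ⊗-distribˡ-⊕ ⟩
  raise b (A ⊗ B₀ ⊕ A ⊗ raise a B)                   ≈⟨ raise-⊕ b ⟩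
  raise b (A ⊗ B₀) ⊕ raise b (A ⊗ raise a B)         ≈⟨ ⊕-cong ≅-refl (raise-cong b (raise-⊗ʳ {A} {B} a)) ⟩
  raise b (A ⊗ B₀) ⊕ raise b (raise a (A ⊗ B))       ≈⟨ ⊕-cong ≅-refl (raise-split b a (+-comm a b)) ⟨
  raise b (A ⊗ B₀) ⊕ raise (a + b) (A ⊗ B)           ∎
  where open ≅-Reasoning


-- Fibres and guarded recursion

Fib : Graded → ℕ → Set
Fib A n = Σ (Carrier A) (λ a → size A a ≡ n)

Fib-cong : {A B : Graded} → A ≅ B → ∀ n → Fib A n ↔ Fib B n
Fib-cong (mk≅ f s) n = Σ.cong f λ {a} →
  prop-↔ ≡-irrelevant ≡-irrelevant (mk⇔ (trans (s a)) (trans (sym (s a))))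

Carrier↔ΣFib : (A : Graded) → Carrier A ↔ Σ ℕ (Fib A)
Carrier↔ΣFib A = mk↔ₛ′ (λ a → size A a , a , refl) (λ (_ , a , _) → a)
  (λ { (_ , a , refl) → refl }) (λ _ → refl)

fibrewise : {A B : Graded} → (∀ n → Fib A n ↔ Fib B n) → A ≅ B
fibrewise {A} {B} h =
  mk≅ (↔-trans (Carrier↔ΣFib A) (↔-trans (Σ.congˡ (h _)) (↔-sym (Carrier↔ΣFib B))))
      (λ a → proj₂ (to (h (size A a)) (a , refl)))

Fib-⊕ : {A B : Graded} (n : ℕ) → Fib (A ⊕ B) n ↔ (Fib A n ⊎ Fib B n)
Fib-⊕ n = Σ-distribʳ-⊎

Fib-⨁ : {K : Set} {X : K → Graded} (n : ℕ) → Fib (⨁ K X) n ↔ Σ K (λ k → Fib (X k) n)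
Fib-⨁ n = Σ-assoc

Fib-raise : {A : Graded} (c n : ℕ) → Fib (raise c A) n ↔ (c ≤ n × Fib A (n ∸ c))
Fib-raise {A} c n = mk↔ₛ′ t f t∘f f∘t
  where
  t : Fib (raise c A) n → c ≤ n × Fib A (n ∸ c)
  t (a , e) = subst (c ≤_) e (m≤m+n c _) , a , trans (sym (m+n∸m≡n c _)) (cong (_∸ c) e)
  f : c ≤ n × Fib A (n ∸ c) → Fib (raise c A) n
  f (c≤n , a , e) = a , trans (cong (c +_) e) (m+[n∸m]≡n c≤n)
  t∘f : ∀ x → t (f x) ≡ x
  t∘f (c≤n , a , e) = cong₂ (λ p q → p , a , q) (≤-irrelevant _ _) (≡-irrelevant _ _)
  f∘t : ∀ x → f (t x) ≡ x
  f∘t (a , e) = cong (a ,_) (≡-irrelevant _ _)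

Fib-⊗ : {A B : Graded} (n : ℕ) →
        Fib (A ⊗ B) n ↔ Σ ℕ (λ t → t ≤ n × Fib A t × Fib B (n ∸ t))
Fib-⊗ {A} {B} n = mk↔ₛ′ t f t∘f f∘t
  where
  t : Fib (A ⊗ B) n → Σ ℕ (λ t → t ≤ n × Fib A t × Fib B (n ∸ t))
  t ((a , b) , e) = size A a , subst (size A a ≤_) e (m≤m+n _ _) , (a , refl) ,
                    (b , trans (sym (m+n∸m≡n (size A a) _)) (cong (_∸ size A a) e))
  f : Σ ℕ (λ t → t ≤ n × Fib A t × Fib B (n ∸ t)) → Fib (A ⊗ B) n
  f (_ , t≤n , (a , refl) , (b , e)) = (a , b) , trans (cong (size A a +_) e) (m+[n∸m]≡n t≤n)
  t∘f : ∀ x → t (f x) ≡ x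
  t∘f (_ , t≤n , (a , refl) , (b , e)) =
    cong₂ (λ p q → _ , p , (a , refl) , (b , q)) (≤-irrelevant _ _) (≡-irrelevant _ _)
  f∘t : ∀ x → f (t x) ≡ x
  f∘t ((a , b) , e) = cong ((a , b) ,_) (≡-irrelevant _ _)

module _ {I : Set} where

  AgreeBelow : (A B : I → Graded) → ℕ → Set
  AgreeBelow A B n = ∀ i {m} → m < n → Fib (A i) m ↔ Fib (B i) m

  Guarded : ((I → Graded) → I → Graded) → Set₁
  Guarded F = ∀ {A B n} → AgreeBelow A B n → ∀ i → Fib (F A i) n ↔ Fib (F B i) n

  guarded-fixpoint-unique : ∀ {F A B} → Guarded F →
    (∀ i → A i ≅ F A i) → (∀ i → B i ≅ F B i) → ∀ i → A i ≅ B i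
  guarded-fixpoint-unique {F} {A} {B} guarded A≅FA B≅FB i = fibrewise (λ n → agree n i)
    where
    agree : ∀ n i → Fib (A i) n ↔ Fib (B i) n
    agree = <-rec _ λ n rec i →
      ↔-trans (Fib-cong (A≅FA i) n)
        (↔-trans (guarded (λ i′ m<n → rec m<n i′) i) (↔-sym (Fib-cong (B≅FB i) n)))

  raise-agree : ∀ {A B n} → AgreeBelow A B n → ∀ {c} → 0 < c → ∀ i →
                Fib (raise c (A i)) n ↔ Fib (raise c (B i)) n
  raise-agree {n = n} agree {c} 0<c i =
    ↔-trans (Fib-raise c n) (↔-trans (Σ.congˡ λ {c≤n} → agree i (∸-monoʳ-< 0<c c≤n))
      (↔-sym (Fib-raise c n)))


-- Graded sets of generating series

ofSeries : Series → Graded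
ofSeries F = graded (Σ ℕ (Fin ∘ F)) proj₁

Fib-ofSeries : (F : Series) (n : ℕ) → Fib (ofSeries F) n ↔ Fin (F n)
Fib-ofSeries F n = mk↔ₛ′ (λ ((m , x) , e) → subst (Fin ∘ F) e x) (λ x → (n , x) , refl)
  (λ _ → refl) (λ { ((m , x) , refl) → refl })

≅-ofSeries : {A : Graded} (F : Series) → (∀ n → Fib A n ↔ Fin (F n)) → A ≅ ofSeries F
≅-ofSeries F h = fibrewise λ n → ↔-trans (h n) (↔-sym (Fib-ofSeries F n))

ofSeries-one : 𝟙 ≅ ofSeries one
ofSeries-one = mk≅ (mk↔ₛ′ (λ _ → 0 , Fin.zero) (λ _ → tt) t∘f (λ _ → refl)) (λ _ → refl)
  where
  t∘f : ∀ x → (0 , Fin.zero) ≡ x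
  t∘f (zero , Fin.zero) = refl

Fin-if : ∀ b x → Fin (if b then x else 0) ↔ (T b × Fin x)
Fin-if true  x = mk↔ₛ′ (tt ,_) proj₂ (λ _ → refl) (λ _ → refl)
Fin-if false x = mk↔ₛ′ (λ ()) (λ ()) (λ ()) (λ ())

sumTo-suc : ∀ N f → sumTo (suc N) f ≡ f 0 + sumTo N (f ∘ suc)
sumTo-suc zero    f = refl
sumTo-suc (suc N) f = trans (cong (_+ f (suc (suc N))) (sumTo-suc N f)) (+-assoc (f 0) _ _)

Σ≤suc↔ : (P : ℕ → Set) (N : ℕ) →
         (P 0 ⊎ Σ ℕ (λ t → t ≤ N × P (suc t))) ↔ Σ ℕ (λ t → t ≤ suc N × P t)
Σ≤suc↔ P N = mk↔ₛ′ t f t∘f f∘t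
  where
  t : P 0 ⊎ Σ ℕ (λ t → t ≤ N × P (suc t)) → Σ ℕ (λ t → t ≤ suc N × P t)
  t (inj₁ x)           = 0 , z≤n , x
  t (inj₂ (t , t≤N , x)) = suc t , s≤s t≤N , x
  f : Σ ℕ (λ t → t ≤ suc N × P t) → P 0 ⊎ Σ ℕ (λ t → t ≤ N × P (suc t))
  f (zero  , _         , x) = inj₁ x
  f (suc t , s≤s t≤N , x) = inj₂ (t , t≤N , x)
  t∘f : ∀ x → t (f x) ≡ x
  t∘f (zero  , z≤n     , x) = refl
  t∘f (suc t , s≤s t≤N , x) = refl
  f∘t : ∀ x → f (t x) ≡ x
  f∘t (inj₁ x) = refl
  f∘t (inj₂ y) = refl

Fin-sumTo : ∀ N f → Fin (sumTo N f) ↔ Σ ℕ (λ t → t ≤ N × Fin (f t))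
Fin-sumTo zero f = mk↔ₛ′ (λ x → 0 , z≤n , x) (λ { (zero , z≤n , x) → x })
  (λ { (zero , z≤n , x) → refl }) (λ _ → refl)
Fin-sumTo (suc N) f = begin
  Fin (sumTo (suc N) f)                        ≡⟨ cong Fin (sumTo-suc N f) ⟩
  Fin (f 0 + sumTo N (f ∘ suc))                ↔⟨ +↔⊎ ⟩
  (Fin (f 0) ⊎ Fin (sumTo N (f ∘ suc)))        ↔⟨ ↔-refl ⊎-↔ Fin-sumTo N (f ∘ suc) ⟩
  (Fin (f 0) ⊎ Σ ℕ (λ t → t ≤ N × Fin (f (suc t)))) ↔⟨ Σ≤suc↔ (Fin ∘ f) N ⟩
  Σ ℕ (λ t → t ≤ suc N × Fin (f t))            ∎
  where open EquationalReasoning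

ofSeries-⊛ : (F G : Series) → ofSeries F ⊗ ofSeries G ≅ ofSeries (F ⊛ G)
ofSeries-⊛ F G = ≅-ofSeries (F ⊛ G) λ n → begin
  Fib (ofSeries F ⊗ ofSeries G) n                                ↔⟨ Fib-⊗ n ⟩
  Σ ℕ (λ t → t ≤ n × Fib (ofSeries F) t × Fib (ofSeries G) (n ∸ t))
    ↔⟨ Σ.congˡ (↔-refl ×-↔ (Fib-ofSeries F _ ×-↔ Fib-ofSeries G _)) ⟩
  Σ ℕ (λ t → t ≤ n × Fin (F t) × Fin (G (n ∸ t)))                  ↔⟨ Σ.congˡ (↔-refl ×-↔ *↔×) ⟨
  Σ ℕ (λ t → t ≤ n × Fin (F t * G (n ∸ t)))                        ↔⟨ Fin-sumTo n _ ⟨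
  Fin ((F ⊛ G) n)                                                  ∎
  where open EquationalReasoning

≤↔≤ᵇ : ∀ m n → (m ≤ n) ↔ T (m ≤ᵇ n)
≤↔≤ᵇ m n = prop-↔ ≤-irrelevant T-irrelevant (mk⇔ ≤⇒≤ᵇ (≤ᵇ⇒≤ m n))

ofSeries-shift : (e : ℕ) (F : Series) → raise e (ofSeries F) ≅ ofSeries (shift e F)
ofSeries-shift e F = ≅-ofSeries (shift e F) λ n → begin
  Fib (raise e (ofSeries F)) n            ↔⟨ Fib-raise e n ⟩
  (e ≤ n × Fib (ofSeries F) (n ∸ e))      ↔⟨ ≤↔≤ᵇ e n ×-↔ Fib-ofSeries F (n ∸ e) ⟩
  (T (e ≤ᵇ n) × Fin (F (n ∸ e)))           ↔⟨ Fin-if (e ≤ᵇ n) _ ⟨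
  Fin (shift e F n)                        ∎
  where open EquationalReasoning

Geom : ℕ → Graded
Geom c = graded ℕ (c *_)

Geom-unfold : (c : ℕ) → Geom c ≅ 𝟙 ⊕ raise c (Geom c)
Geom-unfold c = mk≅ (mk↔ₛ′ t f t∘f f∘t) size-t
  where
  t : ℕ → ⊤ ⊎ ℕ
  t zero    = inj₁ tt
  t (suc r) = inj₂ r
  f : ⊤ ⊎ ℕ → ℕ
  f (inj₁ _) = zero
  f (inj₂ r) = suc r
  t∘f : ∀ x → t (f x) ≡ x
  t∘f (inj₁ _) = refl
  t∘f (inj₂ r) = refl
  f∘t : ∀ r → f (t r) ≡ r
  f∘t zero    = refl
  f∘t (suc r) = refl
  size-t : ∀ r → size (𝟙 ⊕ raise c (Geom c)) (t r) ≡ c * r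
  size-t zero    = sym (*-zeroʳ c)
  size-t (suc r) = sym (*-suc c r)

Geom≅ofSeries : (c : ℕ) .{{_ : NonZero c}} → Geom c ≅ ofSeries (geom c)
Geom≅ofSeries c = ≅-ofSeries (geom c) fibre
  where
  fibre : ∀ n → Fib (Geom c) n ↔ Fin (geom c n)
  fibre n = begin
    Fib (Geom c) n         ↔⟨ prop-↔ Fib-irrelevant T-irrelevant (mk⇔ (fromWitness ∘ divisor) multiple) ⟩
    T ⌊ c ∣? n ⌋           ↔⟨ mk↔ₛ′ (_, Fin.zero) proj₁ (λ { (_ , Fin.zero) → refl ; (_ , Fin.suc ()) })
                                    (λ _ → refl) ⟩
    (T ⌊ c ∣? n ⌋ × Fin 1) ↔⟨ Fin-if ⌊ c ∣? n ⌋ 1 ⟨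
    Fin (geom c n)         ∎
    where
    open EquationalReasoning
    divisor : Fib (Geom c) n → c ∣ n
    divisor (r , e) = divides r (trans (sym e) (*-comm c r))
    multiple : T ⌊ c ∣? n ⌋ → Fib (Geom c) n
    multiple p with divides q e ← toWitness p = q , trans (*-comm c q) (sym e)
    Fib-irrelevant : Irrelevant (Fib (Geom c) n)
    Fib-irrelevant (r , e) (r′ , e′) with refl ← *-cancelˡ-≡ r r′ c (trans e (sym e′)) =
      cong (r ,_) (≡-irrelevant e e′)


T-allᵇ : ∀ p l → T (allᵇ p l) ⇔ All (T ∘ p) l
T-allᵇ p []      = mk⇔ (λ _ → []) (λ _ → tt)
T-allᵇ p (x ∷ l) = mk⇔
  (λ t → let px , pl = Equivalence.to (T-∧ {p x} {allᵇ p l}) t in px ∷ Equivalence.to (T-allᵇ p l) pl)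
  (λ pl → Equivalence.from T-∧ (All.head pl , Equivalence.from (T-allᵇ p l) (All.tail pl)))

T-nondecᵇ : ∀ l → T (nondecᵇ l) ⇔ Linked _≤_ l
T-nondecᵇ []          = mk⇔ (λ _ → []) (λ _ → tt)
T-nondecᵇ (x ∷ [])    = mk⇔ (λ _ → [-]) (λ _ → tt)
T-nondecᵇ (x ∷ y ∷ l) = mk⇔
  (λ t → let x≤y , ok = Equivalence.to (T-∧ {x ≤ᵇ y} {nondecᵇ (y ∷ l)}) t in
         ≤ᵇ⇒≤ x y x≤y ∷ Equivalence.to (T-nondecᵇ (y ∷ l)) ok)
  (λ lk → Equivalence.from T-∧ (≤⇒≤ᵇ (Linked.head lk) , Equivalence.from (T-nondecᵇ (y ∷ l)) (Linked.tail lk)))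

T-incᵇ : ∀ l → T (incᵇ l) ⇔ Linked _<_ l
T-incᵇ []          = mk⇔ (λ _ → []) (λ _ → tt)
T-incᵇ (x ∷ [])    = mk⇔ (λ _ → [-]) (λ _ → tt)
T-incᵇ (x ∷ y ∷ l) = mk⇔
  (λ t → let x<y , ok = Equivalence.to (T-∧ {x <ᵇ y} {incᵇ (y ∷ l)}) t in
         <ᵇ⇒< x y x<y ∷ Equivalence.to (T-incᵇ (y ∷ l)) ok)
  (λ lk → Equivalence.from T-∧ (<⇒<ᵇ (Linked.head lk) , Equivalence.from (T-incᵇ (y ∷ l)) (Linked.tail lk)))

Linked-∷ : {R : ℕ → ℕ → Set} → ∀ {x l} → All (R x) l → Linked R l → Linked R (x ∷ l)
Linked-∷ []      _  = [-]
Linked-∷ (r ∷ _) lk = r ∷ lk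

Linked⇒All-tail : {R : ℕ → ℕ → Set} → Transitive R → ∀ {x l} → Linked R (x ∷ l) → All (R x) l
Linked⇒All-tail trans [-]      = []
Linked⇒All-tail trans (r ∷ lk) = Linked⇒All trans r lk

map-∸-+ : ∀ a l → map (_∸ a) (map (a +_) l) ≡ l
map-∸-+ a l = trans (sym (map-∘ l)) (trans (map-cong (m+n∸m≡n a) l) (map-id l))

map-+-∸ : ∀ a {l} → All (a ≤_) l → map (a +_) (map (_∸ a) l) ≡ l
map-+-∸ a {l} a≤l = trans (sym (map-∘ l)) (map-id-local (All.map m+[n∸m]≡n a≤l))

sum-map-+ : ∀ a l → sum (map (a +_) l) ≡ length l * a + sum l
sum-map-+ a []      = refl
sum-map-+ a (x ∷ l) = trans (cong ((a + x) +_) (sum-map-+ a l)) (lemma a x (length l * a) (sum l))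
  where
  lemma : ∀ a x m s → a + x + (m + s) ≡ a + m + (x + s)
  lemma = solve-∀


-- Partitions into multiples of k

multipleᵇ : ℕ → ℕ → Bool
multipleᵇ k x = ⌊ k ∣? x ⌋

-- ℰ[ k , m ] with every partition padded by zeros to exactly m parts; see ℰ≅Tuples.
IsTuple : ℕ → ℕ → List ℕ → Set
IsTuple k m l = length l ≡ m × Linked _≤_ l × All (T ∘ multipleᵇ k) l

IsTuple-irrelevant : ∀ {k m l} → Irrelevant (IsTuple k m l)
IsTuple-irrelevant = ×-irrelevant ≡-irrelevant
  (×-irrelevant (Linked.irrelevant ≤-irrelevant) (All.irrelevant T-irrelevant))

Tuples : ℕ → ℕ → Graded
Tuples k m = graded (Σ (List ℕ) (IsTuple k m)) (sum ∘ proj₁)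

Tuples-zero : (k : ℕ) → Tuples k 0 ≅ 𝟙
Tuples-zero k = mk≅ (mk↔ₛ′ (λ _ → tt) (λ _ → [] , refl , [] , []) (λ _ → refl) f∘t) size-t
  where
  f∘t : ∀ x → ([] , refl , [] , []) ≡ x
  f∘t ([] , _) = Σ-≡-irrelevant IsTuple-irrelevant refl
  f∘t (_ ∷ _ , () , _)
  size-t : ∀ x → 0 ≡ sum (proj₁ x)
  size-t ([] , _) = refl
  size-t (_ ∷ _ , () , _)

∣m∣n⇒∣n∸m : ∀ {d m n} → d ∣ m → d ∣ n → m ≤ n → d ∣ n ∸ m
∣m∣n⇒∣n∸m d∣m d∣n m≤n = ∣m+n∣m⇒∣n (subst (_ ∣_) (sym (m+[n∸m]≡n m≤n)) d∣n) d∣m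

add-minimum : (k m : ℕ) .{{_ : NonZero k}} → Tuples k m ⊗ Geom (k * suc m) ≅ Tuples k (suc m)
add-minimum k m = mk≅ (mk↔ₛ′ t f t∘f f∘t) size-t
  where
  t : Carrier (Tuples k m ⊗ Geom (k * suc m)) → Carrier (Tuples k (suc m))
  t ((l , len , lk , dv) , r) =
    k * r ∷ map (k * r +_) l ,
    cong suc (trans (length-map _ l) len) ,
    Linked-∷ (map⁺ (All.universal (m≤m+n (k * r)) l)) (Linked.map⁺ (Linked.map (+-monoʳ-≤ (k * r)) lk)) ,
    fromWitness (m∣m*n r) ∷ map⁺ (All.map (λ p → fromWitness (∣m∣n⇒∣m+n (m∣m*n r) (toWitness p))) dv)
  f : Carrier (Tuples k (suc m)) → Carrier (Tuples k m ⊗ Geom (k * suc m))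
  f (x ∷ l , len , lk , kx ∷ dv) =
    (map (_∸ x) l ,
     trans (length-map _ l) (suc-injective len) ,
     Linked.map⁺ (Linked.map (∸-monoˡ-≤ x) (Linked.tail lk)) ,
     map⁺ (All.zipWith (λ (x≤y , p) → fromWitness (∣m∣n⇒∣n∸m (toWitness kx) (toWitness p) x≤y))
                       (Linked⇒All-tail ≤-trans lk , dv))) ,
    x / k
  t∘f : ∀ x → t (f x) ≡ x
  t∘f (x ∷ l , len , lk , kx ∷ dv) = Σ-≡-irrelevant IsTuple-irrelevant (begin
    k * (x / k) ∷ map (k * (x / k) +_) (map (_∸ x) l)
      ≡⟨ cong (λ a → a ∷ map (a +_) (map (_∸ x) l)) (m*[n/m]≡n (toWitness kx)) ⟩
    x ∷ map (x +_) (map (_∸ x) l)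
      ≡⟨ cong (x ∷_) (map-+-∸ x (Linked⇒All-tail ≤-trans lk)) ⟩
    x ∷ l ∎)
    where open ≡-Reasoning
  f∘t : ∀ x → f (t x) ≡ x
  f∘t ((l , _) , r) = cong₂ _,_ (Σ-≡-irrelevant IsTuple-irrelevant (map-∸-+ (k * r) l))
                                (trans (cong (_/ k) (*-comm k r)) (m*n/n≡m r k))
  size-t : ∀ x → size (Tuples k (suc m)) (t x) ≡ size (Tuples k m ⊗ Geom (k * suc m)) x
  size-t ((l , len , _) , r) = begin
    k * r + sum (map (k * r +_) l)       ≡⟨ cong (k * r +_) (sum-map-+ (k * r) l) ⟩
    k * r + (length l * (k * r) + sum l) ≡⟨ cong (λ n → k * r + (n * (k * r) + sum l)) len ⟩
    k * r + (m * (k * r) + sum l)        ≡⟨ lemma k m r (sum l) ⟩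
    sum l + k * suc m * r                ∎
    where
    open ≡-Reasoning
    lemma : ∀ k m r s → k * r + (m * (k * r) + s) ≡ s + k * suc m * r
    lemma = solve-∀

Tuples≅invPoch : (k m : ℕ) .{{_ : NonZero k}} → Tuples k m ≅ ofSeries (invPoch k m)
Tuples≅invPoch k zero    = ≅-trans (Tuples-zero k) ofSeries-one
Tuples≅invPoch k (suc m) = begin
  Tuples k (suc m)
    ≈⟨ add-minimum k m ⟨
  Tuples k m ⊗ Geom (k * suc m)
    ≈⟨ ⊗-cong (Tuples≅invPoch k m) (Geom≅ofSeries (k * suc m) {{m*n≢0 k (suc m)}}) ⟩
  ofSeries (invPoch k m) ⊗ ofSeries (geom (k * suc m))
    ≈⟨ ofSeries-⊛ (invPoch k m) (geom (k * suc m)) ⟩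
  ofSeries (invPoch k (suc m)) ∎
  where open ≅-Reasoning

Tuples-split : (k m : ℕ) .{{_ : NonZero k}} →
               Tuples k (suc m) ≅ Tuples k m ⊕ raise (k * suc m) (Tuples k (suc m))
Tuples-split k m = begin
  Tuples k (suc m)                                 ≈⟨ add-minimum k m ⟨
  Tuples k m ⊗ Geom c                              ≈⟨ ⊗-cong ≅-refl (Geom-unfold c) ⟩
  Tuples k m ⊗ (𝟙 ⊕ raise c (Geom c))              ≈⟨ ⊗-distribˡ-⊕ ⟩
  Tuples k m ⊗ 𝟙 ⊕ Tuples k m ⊗ raise c (Geom c)   ≈⟨ ⊕-cong ⊗-identityʳ (raise-⊗ʳ {Tuples k m} c) ⟩
  Tuples k m ⊕ raise c (Tuples k m ⊗ Geom c)       ≈⟨ ⊕-cong ≅-refl (raise-cong c (add-minimum k m)) ⟩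
  Tuples k m ⊕ raise c (Tuples k (suc m))          ∎
  where
  open ≅-Reasoning
  c = k * suc m

dropZeros : List ℕ → List ℕ
dropZeros (zero ∷ l) = dropZeros l
dropZeros l          = l

dropZeros-preserves : {P : List ℕ → Set} → (∀ {x l} → P (x ∷ l) → P l) →
                      ∀ {l} → P l → P (dropZeros l)
dropZeros-preserves         P-tail {[]}        p = p
dropZeros-preserves {P = P} P-tail {zero ∷ l}  p = dropZeros-preserves {P} P-tail {l} (P-tail p)
dropZeros-preserves         P-tail {suc x ∷ l} p = p

dropZeros-positive : ∀ {l} → Linked _≤_ l → All (0 <_) (dropZeros l)
dropZeros-positive {[]}        _  = []
dropZeros-positive {zero ∷ l}  lk = dropZeros-positive (Linked.tail lk)
dropZeros-positive {suc x ∷ l} lk = Linked⇒All ≤-trans (s≤s z≤n) lk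

padZeros : ℕ → List ℕ → List ℕ
padZeros m l = replicate (m ∸ length l) 0 ++ l

padZeros-dropZeros : ∀ l → padZeros (length l) (dropZeros l) ≡ l
padZeros-dropZeros []          = refl
padZeros-dropZeros (zero ∷ l)  =
  trans (cong (λ z → replicate z 0 ++ dropZeros l) (+-∸-assoc 1 length-dropZeros))
        (cong (0 ∷_) (padZeros-dropZeros l))
  where
  length-dropZeros : length (dropZeros l) ≤ length l
  length-dropZeros = dropZeros-preserves {λ l′ → length l′ ≤ length l} (≤-trans (n≤1+n _)) {l} ≤-refl
padZeros-dropZeros (suc x ∷ l) = cong (λ z → replicate z 0 ++ suc x ∷ l) (n∸n≡0 (length l))

dropZeros-replicate : ∀ z {l} → All (0 <_) l → dropZeros (replicate z 0 ++ l) ≡ l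
dropZeros-replicate (suc z) pos        = dropZeros-replicate z pos
dropZeros-replicate zero    []         = refl
dropZeros-replicate zero    (s≤s _ ∷ _) = refl

sum-replicate-0 : ∀ z l → sum (replicate z 0 ++ l) ≡ sum l
sum-replicate-0 zero    l = refl
sum-replicate-0 (suc z) l = sum-replicate-0 z l

Linked-replicate-0 : ∀ z {l} → Linked _≤_ l → Linked _≤_ (replicate z 0 ++ l)
Linked-replicate-0 zero    lk = lk
Linked-replicate-0 (suc z) lk = Linked-∷ (All.universal (λ _ → z≤n) _) (Linked-replicate-0 z lk)

IsBoundedPartition : ℕ → ℕ → List ℕ → Set
IsBoundedPartition k m l = All (0 <_) l × Linked _≤_ l × All (T ∘ multipleᵇ k) l × length l ≤ m

T-isEᵇ : ∀ k m l → T (isEᵇ k m l) ⇔ IsBoundedPartition k m l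
T-isEᵇ k m l = mk⇔
  (λ t → let pn , dl = Equivalence.to (T-∧ {isPartitionᵇ l}) t
             p , n = Equivalence.to (T-∧ {allᵇ (1 ≤ᵇ_) l}) pn
             d , len = Equivalence.to (T-∧ {allᵇ (multipleᵇ k) l}) dl
         in All.map (≤ᵇ⇒≤ 1 _) (Equivalence.to (T-allᵇ _ l) p) ,
            Equivalence.to (T-nondecᵇ l) n , Equivalence.to (T-allᵇ _ l) d , ≤ᵇ⇒≤ _ m len)
  (λ (p , n , d , len) → Equivalence.from T-∧
    (Equivalence.from T-∧ (Equivalence.from (T-allᵇ _ l) (All.map ≤⇒≤ᵇ p) , Equivalence.from (T-nondecᵇ l) n) ,
     Equivalence.from T-∧ (Equivalence.from (T-allᵇ _ l) d , ≤⇒≤ᵇ len)))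

ℰG : ℕ → ℕ → Graded
ℰG k m = graded ℰ[ k , m ] (sum ∘ proj₁)

ℰ≅Tuples : (k m : ℕ) → ℰG k m ≅ Tuples k m
ℰ≅Tuples k m = mk≅ (mk↔ₛ′ t f t∘f f∘t) size-t
  where
  t : ℰ[ k , m ] → Carrier (Tuples k m)
  t (l , e) with pos , lk , dv , len ← Equivalence.to (T-isEᵇ k m l) e =
    padZeros m l ,
    trans (length-++ (replicate (m ∸ length l) 0))
          (trans (cong (_+ length l) (length-replicate (m ∸ length l))) (m∸n+n≡m len)) ,
    Linked-replicate-0 (m ∸ length l) lk ,
    ++⁺ (replicate⁺ _ (fromWitness (k ∣0))) dv
  f : Carrier (Tuples k m) → ℰ[ k , m ]
  f (l , len , lk , dv) = dropZeros l , Equivalence.from (T-isEᵇ k m (dropZeros l))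
    (dropZeros-positive lk ,
     dropZeros-preserves {Linked _≤_} Linked.tail {l} lk ,
     dropZeros-preserves {All (T ∘ multipleᵇ k)} All.tail {l} dv ,
     dropZeros-preserves {λ l′ → length l′ ≤ m} (≤-trans (n≤1+n _)) {l} (≤-reflexive len))
  t∘f : ∀ x → t (f x) ≡ x
  t∘f (l , refl , _) = Σ-≡-irrelevant IsTuple-irrelevant (padZeros-dropZeros l)
  f∘t : ∀ x → f (t x) ≡ x
  f∘t (l , e) = Σ-≡-irrelevant T-irrelevant
    (dropZeros-replicate (m ∸ length l) (proj₁ (Equivalence.to (T-isEᵇ k m l) e)))
  size-t : ∀ x → sum (proj₁ (t x)) ≡ sum (proj₁ x)
  size-t (l , e) = sum-replicate-0 (m ∸ length l) l

ℰ-split : (k m : ℕ) .{{_ : NonZero k}} → ℰG k (suc m) ≅ ℰG k m ⊕ raise (k * suc m) (ℰG k (suc m))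
ℰ-split k m = begin
  ℰG k (suc m)                                   ≈⟨ ℰ≅Tuples k (suc m) ⟩
  Tuples k (suc m)                               ≈⟨ Tuples-split k m ⟩
  Tuples k m ⊕ raise (k * suc m) (Tuples k (suc m))
    ≈⟨ ⊕-cong (ℰ≅Tuples k m) (raise-cong (k * suc m) (ℰ≅Tuples k (suc m))) ⟨
  ℰG k m ⊕ raise (k * suc m) (ℰG k (suc m))      ∎
  where open ≅-Reasoning

ℰ≅invPoch : (k m : ℕ) .{{_ : NonZero k}} → ℰG k m ≅ ofSeries (invPoch k m)
ℰ≅invPoch k m = ≅-trans (ℰ≅Tuples k m) (Tuples≅invPoch k m)


-- Runs of parts differing by 2

runsFrom : ℕ → ℕ → List ℕ → List ℕ
runsFrom p n []       = n ∷ []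
runsFrom p n (y ∷ ys) = if y ≡ᵇ p + 2 then runsFrom y (suc n) ys else n ∷ runsFrom y 1 ys

runs : List ℕ → List ℕ
runs []       = []
runs (x ∷ xs) = runsFrom x 1 xs

-- `runLengths` and `sol2` compute with local functions that cannot be named; the one of `runLengths`
-- also takes the clause variables x, xs as two leading arguments. Each is captured below by a
-- top-level meta, which unification solves once the `with`s expose it applied to distinct variables.
runsFrom-unique : {G : ℕ → List ℕ → ℕ → ℕ → List ℕ → List ℕ} →
  (∀ x xs p n → G x xs p n [] ≡ n ∷ []) →
  (∀ x xs p n y ys → G x xs p n (y ∷ ys) ≡ (if y ≡ᵇ p + 2 then G x xs y (suc n) ys else n ∷ G x xs y 1 ys)) →
  ∀ x xs p n ys → G x xs p n ys ≡ runsFrom p n ys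
runsFrom-unique G-[] G-∷ x xs p n [] = G-[] x xs p n
runsFrom-unique {G} G-[] G-∷ x xs p n (y ∷ ys) rewrite G-∷ x xs p n y ys with y ≡ᵇ p + 2
... | true  = runsFrom-unique {G} G-[] G-∷ x xs y (suc n) ys
... | false = cong (n ∷_) (runsFrom-unique {G} G-[] G-∷ x xs y 1 ys)

mutual
  private
    runLengths-go : ℕ → List ℕ → ℕ → ℕ → List ℕ → List ℕ
    runLengths-go = _

  runLengths≡runs : ∀ l → runLengths l ≡ runs l
  runLengths≡runs []      = refl
  runLengths≡runs (x ∷ []) = refl
  runLengths≡runs (x ∷ y ∷ ys) with y ≡ᵇ x + 2
  ... | true  with y ∷ ys | 2
  ...   | zs | n = runsFrom-unique {runLengths-go} (λ _ _ _ _ → refl) (λ _ _ _ _ _ _ → refl) x zs y n ys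
  runLengths≡runs (x ∷ y ∷ ys) | false with y ∷ ys | 1
  ...   | zs | n =
    cong (n ∷_) (runsFrom-unique {runLengths-go} (λ _ _ _ _ → refl) (λ _ _ _ _ _ _ → refl) x zs y n ys)

parity : ℕ → ℕ
parity n = if oddᵇ n then 1 else 0

countOdd-unique : {G : List ℕ → List ℕ → ℕ} → (∀ l → G l [] ≡ 0) →
  (∀ l r rs → G l (r ∷ rs) ≡ (if oddᵇ r then suc (G l rs) else G l rs)) →
  ∀ l rs → G l rs ≡ sum (map parity rs)
countOdd-unique G-[] G-∷ l [] = G-[] l
countOdd-unique {G} G-[] G-∷ l (r ∷ rs) rewrite G-∷ l r rs with oddᵇ r
... | true  = cong suc (countOdd-unique {G} G-[] G-∷ l rs)
... | false = countOdd-unique {G} G-[] G-∷ l rs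

oddRuns runPairs : List ℕ → ℕ
oddRuns  l = sum (map parity (runs l))
runPairs l = sum (map ⌊_/2⌋ (runs l))

mutual
  private
    sol2-countOdd : List ℕ → List ℕ → ℕ
    sol2-countOdd = _

  sol2≡oddRuns : ∀ l → sol2 l ≡ oddRuns l
  sol2≡oddRuns l rewrite sym (runLengths≡runs l) with runLengths l
  ... | R = countOdd-unique {sol2-countOdd} (λ _ → refl) (λ _ _ _ → refl) l R

≡ᵇ-shift : ∀ k y p → (k + y ≡ᵇ k + p + 2) ≡ (y ≡ᵇ p + 2)
≡ᵇ-shift zero    y p = refl
≡ᵇ-shift (suc k) y p = ≡ᵇ-shift k y p

runsFrom-shift : ∀ k p n ys → runsFrom (k + p) n (map (k +_) ys) ≡ runsFrom p n ys
runsFrom-shift k p n []       = refl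
runsFrom-shift k p n (y ∷ ys) rewrite ≡ᵇ-shift k y p with y ≡ᵇ p + 2
... | true  = runsFrom-shift k y (suc n) ys
... | false = cong (n ∷_) (runsFrom-shift k y 1 ys)

runs-shift : ∀ k l → runs (map (k +_) l) ≡ runs l
runs-shift k []      = refl
runs-shift k (x ∷ l) = runsFrom-shift k x 1 l

runs-single : ∀ l → runs (1 ∷ map (4 +_) l) ≡ 1 ∷ runs l
runs-single []      = refl
runs-single (x ∷ l) = cong (1 ∷_) (runsFrom-shift 4 x 1 l)

module RunSum (f : ℕ → ℕ) {c : ℕ} (f-0 : f 0 ≡ 0) (f-2+ : ∀ r → f (2 + r) ≡ c + f r) where

  runsFrom-2+ : ∀ p n ys → sum (map f (runsFrom p (2 + n) ys)) ≡ c + sum (map f (runsFrom p n ys))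
  runsFrom-2+ p n [] = trans (cong (_+ 0) (f-2+ n)) (+-assoc c (f n) 0)
  runsFrom-2+ p n (y ∷ ys) with y ≡ᵇ p + 2
  ... | true  = runsFrom-2+ y (suc n) ys
  ... | false = trans (cong (_+ rest) (f-2+ n)) (+-assoc c (f n) rest)
    where rest = sum (map f (runsFrom y 1 ys))

  sum-map-f-shift : ∀ x l → sum (map f (runsFrom (4 + x) 1 (map (4 +_) l))) ≡ sum (map f (runs (x ∷ l)))
  sum-map-f-shift x l = cong (sum ∘ map f) (runsFrom-shift 4 x 1 l)

  f-2 : f 2 ≡ c
  f-2 = trans (f-2+ 0) (trans (cong (c +_) f-0) (+-identityʳ c))

  runSum-pair : ∀ l → sum (map f (runs (1 ∷ 3 ∷ map (4 +_) l))) ≡ c + sum (map f (runs l))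
  runSum-pair []                = trans (+-identityʳ (f 2)) (trans f-2 (sym (+-identityʳ c)))
  runSum-pair (zero ∷ l)        = cong (_+ _) f-2 ⟨ trans ⟩ cong (c +_) (sum-map-f-shift 0 l)
  runSum-pair (suc zero ∷ l)    = runsFrom-2+ 5 1 (map (4 +_) l) ⟨ trans ⟩ cong (c +_) (sum-map-f-shift 1 l)
  runSum-pair (suc (suc x) ∷ l) = cong (_+ _) f-2 ⟨ trans ⟩ cong (c +_) (sum-map-f-shift (2 + x) l)

oddRuns-pair : ∀ l → oddRuns (1 ∷ 3 ∷ map (4 +_) l) ≡ oddRuns l
oddRuns-pair = RunSum.runSum-pair parity refl (λ _ → refl)

runPairs-pair : ∀ l → runPairs (1 ∷ 3 ∷ map (4 +_) l) ≡ suc (runPairs l)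
runPairs-pair = RunSum.runSum-pair ⌊_/2⌋ refl (λ _ → refl)

sum-runsFrom : ∀ p n ys → sum (runsFrom p n ys) ≡ n + length ys
sum-runsFrom p n []       = refl
sum-runsFrom p n (y ∷ ys) with y ≡ᵇ p + 2
... | true  = trans (sum-runsFrom y (suc n) ys) (sym (+-suc n (length ys)))
... | false = cong (n +_) (sum-runsFrom y 1 ys)

parity+2*half : ∀ n → parity n + 2 * ⌊ n /2⌋ ≡ n
parity+2*half zero          = refl
parity+2*half (suc zero)    = refl
parity+2*half (suc (suc n)) = trans (lemma (parity n) ⌊ n /2⌋) (cong (2 +_) (parity+2*half n))
  where
  lemma : ∀ a h → a + 2 * suc h ≡ 2 + (a + 2 * h)
  lemma = solve-∀

sum≡parities+2halves : ∀ R → sum (map parity R) + 2 * sum (map ⌊_/2⌋ R) ≡ sum R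
sum≡parities+2halves []      = refl
sum≡parities+2halves (r ∷ R) = begin
  (parity r + sum (map parity R)) + 2 * (⌊ r /2⌋ + sum (map ⌊_/2⌋ R))
    ≡⟨ lemma (parity r) (sum (map parity R)) ⌊ r /2⌋ (sum (map ⌊_/2⌋ R)) ⟩
  (parity r + 2 * ⌊ r /2⌋) + (sum (map parity R) + 2 * sum (map ⌊_/2⌋ R))
    ≡⟨ cong₂ _+_ (parity+2*half r) (sum≡parities+2halves R) ⟩
  r + sum R ∎
  where
  open ≡-Reasoning
  lemma : ∀ a b h s → (a + b) + 2 * (h + s) ≡ (a + 2 * h) + (b + 2 * s)
  lemma = solve-∀

length≡oddRuns+2runPairs : ∀ l → length l ≡ oddRuns l + 2 * runPairs l
length≡oddRuns+2runPairs []      = refl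
length≡oddRuns+2runPairs (x ∷ l) =
  trans (sym (sum-runsFrom x 1 l)) (sym (sum≡parities+2halves (runs (x ∷ l))))


-- The recursion

parts : ℕ → ℕ → ℕ
parts i j = i + 2 * j

-- The summands: the partition is empty, starts with 1, 3, starts with a lone 1, or has all parts at
-- least 3. Each raise is the size removed by deleting the leading parts and subtracting 4, resp. 2,
-- from each of the i + 2j remaining parts.
Empty : ℕ → ℕ → Graded
Empty i j = ⨁ (parts i j ≡ 0) (λ _ → 𝟙)

PairFirst SingleFirst Lifted : (ℕ → ℕ → Graded) → ℕ → ℕ → Graded
PairFirst   A i j = ⨁ (Σ ℕ λ j′ → j ≡ suc j′) (λ (j′ , _) → raise (4 + 4 * parts i j′) (A i j′))
SingleFirst A i j = ⨁ (Σ ℕ λ i′ → i ≡ suc i′) (λ (i′ , _) → raise (suc (4 * parts i′ j)) (A i′ j))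
Lifted      A i j = ⨁ (0 < parts i j) (λ _ → raise (2 * parts i j) (A i j))

Unfold : (ℕ → ℕ → Graded) → ℕ → ℕ → Graded
Unfold A i j = Empty i j ⊕ PairFirst A i j ⊕ SingleFirst A i j ⊕ Lifted A i j

Unfold-guarded : Guarded {ℕ × ℕ} (λ A (i , j) → Unfold (curry A) i j)
Unfold-guarded {n = n} agree (i , j) =
  ⊕-agree ↔-refl (⊕-agree (⨁-agree λ (j′ , _) → raise-agree agree (s≤s z≤n) (i , j′))
                 (⊕-agree (⨁-agree λ (i′ , _) → raise-agree agree (s≤s z≤n) (i′ , j))
                          (⨁-agree λ 0<p → raise-agree agree (≤-trans 0<p (m≤m+n _ _)) (i , j))))
  where
  ⊕-agree : {A B A′ B′ : Graded} → Fib A n ↔ Fib A′ n → Fib B n ↔ Fib B′ n → Fib (A ⊕ B) n ↔ Fib (A′ ⊕ B′) n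
  ⊕-agree f g = ↔-trans (Fib-⊕ n) (↔-trans (f ⊎-↔ g) (↔-sym (Fib-⊕ n)))
  ⨁-agree : {K : Set} {X X′ : K → Graded} → (∀ k → Fib (X k) n ↔ Fib (X′ k) n) → Fib (⨁ K X) n ↔ Fib (⨁ K X′) n
  ⨁-agree h = ↔-trans (Fib-⨁ n) (↔-trans (Σ.congˡ (h _)) (↔-sym (Fib-⨁ n)))

parts≡0 : ∀ {i j} → parts i j ≡ 0 → i ≡ 0 × j ≡ 0
parts≡0 {zero} {zero} _ = refl , refl

successor-irrelevant : ∀ {j} → Irrelevant (Σ ℕ λ j′ → j ≡ suc j′)
successor-irrelevant (j₁ , e₁) (j₂ , e₂) with refl ← suc-injective (trans (sym e₁) e₂) =
  cong (j₁ ,_) (≡-irrelevant e₁ e₂)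

module _ (A : ℕ → ℕ → Graded) where

  Unfold-0-0 : Unfold A 0 0 ≅ 𝟙
  Unfold-0-0 = begin
    Unfold A 0 0        ≈⟨ ⊕-cong (⨁-contract refl (≡-irrelevant refl)) (⊕-cong (⨁-empty λ ())
                          (⊕-cong (⨁-empty λ ()) (⨁-empty λ ()))) ⟩
    𝟙 ⊕ 𝟘 ⊕ 𝟘 ⊕ 𝟘   ≈⟨ ⊕-cong ≅-refl (≅-trans (⊕-cong ≅-refl ⊕-identityˡ) ⊕-identityˡ) ⟩
    𝟙 ⊕ 𝟘            ≈⟨ ⊕-identityʳ ⟩
    𝟙                ∎
    where open ≅-Reasoning

  Unfold-suc-0 : ∀ i →
    Unfold A (suc i) 0 ≅ raise (suc (4 * parts i 0)) (A i 0) ⊕ raise (2 * parts (suc i) 0) (A (suc i) 0)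
  Unfold-suc-0 i = ≅-trans
    (⊕-cong (⨁-empty λ ()) (⊕-cong (⨁-empty λ ()) (⊕-cong (⨁-contract (i , refl) (successor-irrelevant _))
      (⨁-contract (s≤s z≤n) (≤-irrelevant _)))))
    (≅-trans ⊕-identityˡ ⊕-identityˡ)

  Unfold-0-suc : ∀ j →
    Unfold A 0 (suc j) ≅ raise (4 + 4 * parts 0 j) (A 0 j) ⊕ raise (2 * parts 0 (suc j)) (A 0 (suc j))
  Unfold-0-suc j = ≅-trans
    (⊕-cong (⨁-empty λ ()) (⊕-cong (⨁-contract (j , refl) (successor-irrelevant _))
      (⊕-cong (⨁-empty λ ()) (⨁-contract (s≤s z≤n) (≤-irrelevant _)))))
    (≅-trans ⊕-identityˡ (⊕-cong ≅-refl ⊕-identityˡ))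

  Unfold-suc-suc : ∀ i j → Unfold A (suc i) (suc j) ≅
    raise (4 + 4 * parts (suc i) j) (A (suc i) j) ⊕ raise (suc (4 * parts i (suc j))) (A i (suc j)) ⊕
    raise (2 * parts (suc i) (suc j)) (A (suc i) (suc j))
  Unfold-suc-suc i j = ≅-trans
    (⊕-cong (⨁-empty λ ()) (⊕-cong (⨁-contract (j , refl) (successor-irrelevant _))
      (⊕-cong (⨁-contract (i , refl) (successor-irrelevant _)) (⨁-contract (s≤s z≤n) (≤-irrelevant _)))))
    ⊕-identityˡ


-- Odd distinct partitions

OddDistinct : List ℕ → Set
OddDistinct l = Linked _<_ l × All (T ∘ oddᵇ) l

-- j is Σ ⌊r/2⌋ over the 2-sequences (of lengths r) instead of (ℓ(λ) − sol₂(λ))/2; the two agree by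
-- length≡oddRuns+2runPairs, and this way every case of Unfold moves i or j by exactly one.
IsOddParts : ℕ → ℕ → List ℕ → Set
IsOddParts i j l = OddDistinct l × oddRuns l ≡ i × runPairs l ≡ j

IsOddParts-irrelevant : ∀ {i j l} → Irrelevant (IsOddParts i j l)
IsOddParts-irrelevant =
  ×-irrelevant (×-irrelevant (Linked.irrelevant <-irrelevant) (All.irrelevant T-irrelevant))
               (×-irrelevant ≡-irrelevant ≡-irrelevant)

IsOddParts-length : ∀ {i j l} → IsOddParts i j l → length l ≡ parts i j
IsOddParts-length {l = l} (_ , refl , refl) = length≡oddRuns+2runPairs l

OddParts : ℕ → ℕ → Graded
OddParts i j = graded (Σ (List ℕ) (IsOddParts i j)) (sum ∘ proj₁)

OddDistinct-shift : ∀ k → (∀ x → oddᵇ (k + x) ≡ oddᵇ x) → ∀ {l} → OddDistinct l ⇔ OddDistinct (map (k +_) l)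
OddDistinct-shift k odd-k+ = mk⇔
  (λ (lk , od) → Linked.map⁺ (Linked.map (+-monoʳ-< k) lk) , map⁺ (All.map (subst T (sym (odd-k+ _))) od))
  (λ (lk , od) → Linked.map (+-cancelˡ-< k _ _) (Linked.map⁻ lk) , All.map (subst T (odd-k+ _)) (map⁻ od))

OddDistinct-single : ∀ {l} → OddDistinct l ⇔ OddDistinct (1 ∷ map (4 +_) l)
OddDistinct-single {l} = mk⇔
  (λ od → let lk , od′ = Equivalence.to (OddDistinct-shift 4 (λ _ → refl)) od in
          Linked-∷ (map⁺ (All.universal (λ _ → s≤s (s≤s z≤n)) l)) lk , tt ∷ od′)
  (λ (lk , od) → Equivalence.from (OddDistinct-shift 4 (λ _ → refl)) (Linked.tail lk , All.tail od))

OddDistinct-pair : ∀ {l} → OddDistinct l ⇔ OddDistinct (1 ∷ 3 ∷ map (4 +_) l)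
OddDistinct-pair {l} = mk⇔
  (λ od → let lk , od′ = Equivalence.to (OddDistinct-shift 4 (λ _ → refl)) od in
          s≤s (s≤s z≤n) ∷ Linked-∷ (map⁺ (All.universal (λ _ → s≤s (s≤s (s≤s (s≤s z≤n)))) l)) lk , tt ∷ tt ∷ od′)
  (λ (lk , od) → Equivalence.from (OddDistinct-shift 4 (λ _ → refl))
                   (Linked.tail (Linked.tail lk) , All.tail (All.tail od)))

oddRuns-lift : ∀ l → oddRuns (map (2 +_) l) ≡ oddRuns l
oddRuns-lift l = cong (sum ∘ map parity) (runs-shift 2 l)

runPairs-lift : ∀ l → runPairs (map (2 +_) l) ≡ runPairs l
runPairs-lift l = cong (sum ∘ map ⌊_/2⌋) (runs-shift 2 l)

oddRuns-single : ∀ l → oddRuns (1 ∷ map (4 +_) l) ≡ suc (oddRuns l)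
oddRuns-single l = cong (sum ∘ map parity) (runs-single l)

runPairs-single : ∀ l → runPairs (1 ∷ map (4 +_) l) ≡ runPairs l
runPairs-single l = cong (sum ∘ map ⌊_/2⌋) (runs-single l)

IsOddParts-lift : ∀ {i j l} → IsOddParts i j l ⇔ IsOddParts i j (map (2 +_) l)
IsOddParts-lift {l = l} = mk⇔
  (λ (od , eᵢ , eⱼ) → Equivalence.to (OddDistinct-shift 2 (λ _ → refl)) od ,
                       trans (oddRuns-lift l) eᵢ , trans (runPairs-lift l) eⱼ)
  (λ (od , eᵢ , eⱼ) → Equivalence.from (OddDistinct-shift 2 (λ _ → refl)) od ,
                       trans (sym (oddRuns-lift l)) eᵢ , trans (sym (runPairs-lift l)) eⱼ)

IsOddParts-single : ∀ {i i′ j l} → i ≡ suc i′ → IsOddParts i′ j l → IsOddParts i j (1 ∷ map (4 +_) l)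
IsOddParts-single {l = l} e (od , eᵢ , eⱼ) =
  Equivalence.to OddDistinct-single od , trans (oddRuns-single l) (trans (cong suc eᵢ) (sym e)) ,
  trans (runPairs-single l) eⱼ

IsOddParts-pair : ∀ {i j j′ l} → j ≡ suc j′ → IsOddParts i j′ l → IsOddParts i j (1 ∷ 3 ∷ map (4 +_) l)
IsOddParts-pair {l = l} e (od , eᵢ , eⱼ) =
  Equivalence.to OddDistinct-pair od , trans (oddRuns-pair l) eᵢ ,
  trans (runPairs-pair l) (trans (cong suc eⱼ) (sym e))

sum-lift : ∀ l → sum (map (2 +_) l) ≡ 2 * length l + sum l
sum-lift l = trans (sum-map-+ 2 l) (cong (_+ sum l) (*-comm (length l) 2))

sum-single : ∀ l → sum (1 ∷ map (4 +_) l) ≡ suc (4 * length l) + sum l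
sum-single l = cong suc (trans (sum-map-+ 4 l) (cong (_+ sum l) (*-comm (length l) 4)))

sum-pair : ∀ l → sum (1 ∷ 3 ∷ map (4 +_) l) ≡ 4 + 4 * length l + sum l
sum-pair l = cong (4 +_) (trans (sum-map-+ 4 l) (cong (_+ sum l) (*-comm (length l) 4)))

⨁-≡ : {K : Set} {P : K → List ℕ → Set} → Irrelevant K → (∀ {k l} → Irrelevant (P k l)) →
      ∀ {k₁ k₂ l₁ l₂} {p₁ : P k₁ l₁} {p₂ : P k₂ l₂} → l₁ ≡ l₂ →
      _≡_ {A = Σ K λ k → Σ (List ℕ) (P k)} (k₁ , l₁ , p₁) (k₂ , l₂ , p₂)
⨁-≡ irrK irrP {k₁} {k₂} refl with refl ← irrK k₁ k₂ = cong (λ p → _ , _ , p) (irrP _ _)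

pair-restore : ∀ {l} → Linked _<_ (1 ∷ 3 ∷ l) → map (4 +_) (map (_∸ 4) l) ≡ l
pair-restore lk = map-+-∸ 4 (Linked⇒All-tail <-trans (Linked.tail lk))

single-restore : ∀ {y l} → Linked _<_ (1 ∷ 5 + y ∷ l) → map (4 +_) (map (_∸ 4) (5 + y ∷ l)) ≡ 5 + y ∷ l
single-restore lk = map-+-∸ 4 (Linked⇒All <-trans (s≤s (s≤s (s≤s (s≤s z≤n)))) (Linked.tail lk))

lift-restore : ∀ {x l} → Linked _<_ (2 + x ∷ l) → map (2 +_) (map (_∸ 2) (2 + x ∷ l)) ≡ 2 + x ∷ l
lift-restore lk = map-+-∸ 2 (Linked⇒All <-trans (s≤s (s≤s z≤n)) lk)

module OddPartsUnfolding {i j : ℕ} where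

  pairFirst : ∀ l → IsOddParts i j (1 ∷ 3 ∷ map (4 +_) l) → Carrier (PairFirst OddParts i j)
  pairFirst l (od , eᵢ , eⱼ) = (runPairs l , trans (sym eⱼ) (runPairs-pair l)) , l ,
    Equivalence.from OddDistinct-pair od , trans (sym (oddRuns-pair l)) eᵢ , refl

  singleFirst : ∀ l → IsOddParts i j (1 ∷ map (4 +_) l) → Carrier (SingleFirst OddParts i j)
  singleFirst l (od , eᵢ , eⱼ) = (oddRuns l , trans (sym eᵢ) (oddRuns-single l)) , l ,
    Equivalence.from OddDistinct-single od , refl , trans (sym (runPairs-single l)) eⱼ

  lifted : ∀ x l → IsOddParts i j (map (2 +_) (x ∷ l)) → Carrier (Lifted OddParts i j)
  lifted x l v =
    subst (0 <_) (IsOddParts-length v) (s≤s z≤n) , x ∷ l , Equivalence.from IsOddParts-lift v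

  unfold : Carrier (OddParts i j) → Carrier (Unfold OddParts i j)
  unfold ([] , _ , eᵢ , eⱼ) = inj₁ (sym (cong₂ parts eᵢ eⱼ) , tt)
  unfold (0 ∷ _ , (_ , () ∷ _) , _)
  unfold (1 ∷ [] , v) = inj₂ (inj₂ (inj₁ (singleFirst [] v)))
  unfold (1 ∷ 0 ∷ _ , (() ∷ _ , _) , _)
  unfold (1 ∷ 1 ∷ _ , (s≤s () ∷ _ , _) , _)
  unfold (1 ∷ 2 ∷ _ , (_ , _ ∷ () ∷ _) , _)
  unfold (1 ∷ 3 ∷ l , v@((lk , _) , _)) = inj₂ (inj₁ (pairFirst (map (_∸ 4) l)
    (subst (IsOddParts i j) (sym (cong (λ l′ → 1 ∷ 3 ∷ l′) (pair-restore lk))) v)))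
  unfold (1 ∷ 4 ∷ _ , (_ , _ ∷ () ∷ _) , _)
  unfold (1 ∷ suc (suc (suc (suc (suc y)))) ∷ l , v@((lk , _) , _)) = inj₂ (inj₂ (inj₁ (singleFirst
    (map (_∸ 4) (5 + y ∷ l)) (subst (IsOddParts i j) (sym (cong (1 ∷_) (single-restore lk))) v))))
  unfold (suc (suc x) ∷ l , v@((lk , _) , _)) =
    inj₂ (inj₂ (inj₂ (lifted x (map (_∸ 2) l) (subst (IsOddParts i j) (sym (lift-restore lk)) v))))

  fold : Carrier (Unfold OddParts i j) → Carrier (OddParts i j)
  fold (inj₁ (e , _)) = [] , ([] , []) , sym (proj₁ (parts≡0 {i} {j} e)) , sym (proj₂ (parts≡0 {i} {j} e))
  fold (inj₂ (inj₁ ((_ , e) , l , v)))        = 1 ∷ 3 ∷ map (4 +_) l , IsOddParts-pair e v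
  fold (inj₂ (inj₂ (inj₁ ((_ , e) , l , v)))) = 1 ∷ map (4 +_) l , IsOddParts-single e v
  fold (inj₂ (inj₂ (inj₂ (_ , l , v))))       = map (2 +_) l , Equivalence.to IsOddParts-lift v

  fold-size : ∀ y → size (OddParts i j) (fold y) ≡ size (Unfold OddParts i j) y
  fold-size (inj₁ (e , _)) = refl
  fold-size (inj₂ (inj₁ ((_ , e) , l , v))) =
    trans (sum-pair l) (cong (λ n → 4 + 4 * n + sum l) (IsOddParts-length v))
  fold-size (inj₂ (inj₂ (inj₁ ((_ , e) , l , v)))) =
    trans (sum-single l) (cong (λ n → suc (4 * n) + sum l) (IsOddParts-length v))
  fold-size (inj₂ (inj₂ (inj₂ (_ , l , v)))) =
    trans (sum-lift l) (cong (λ n → 2 * n + sum l) (IsOddParts-length v))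

  fold-unfold : ∀ x → fold (unfold x) ≡ x
  fold-unfold ([] , _) = Σ-≡-irrelevant IsOddParts-irrelevant refl
  fold-unfold (0 ∷ _ , (_ , () ∷ _) , _)
  fold-unfold (1 ∷ [] , v) = Σ-≡-irrelevant IsOddParts-irrelevant refl
  fold-unfold (1 ∷ 0 ∷ _ , (() ∷ _ , _) , _)
  fold-unfold (1 ∷ 1 ∷ _ , (s≤s () ∷ _ , _) , _)
  fold-unfold (1 ∷ 2 ∷ _ , (_ , _ ∷ () ∷ _) , _)
  fold-unfold (1 ∷ 3 ∷ l , (lk , _) , _) =
    Σ-≡-irrelevant IsOddParts-irrelevant (cong (λ l′ → 1 ∷ 3 ∷ l′) (pair-restore lk))
  fold-unfold (1 ∷ 4 ∷ _ , (_ , _ ∷ () ∷ _) , _)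
  fold-unfold (1 ∷ suc (suc (suc (suc (suc y)))) ∷ l , (lk , _) , _) =
    Σ-≡-irrelevant IsOddParts-irrelevant (cong (1 ∷_) (single-restore lk))
  fold-unfold (suc (suc x) ∷ l , (lk , _) , _) = Σ-≡-irrelevant IsOddParts-irrelevant (lift-restore lk)

  unfold-fold : ∀ y → unfold (fold y) ≡ y
  unfold-fold (inj₁ (e , _)) = cong (λ e′ → inj₁ (e′ , tt)) (≡-irrelevant _ e)
  unfold-fold (inj₂ (inj₁ ((_ , e) , l , v))) =
    cong (inj₂ ∘ inj₁) (⨁-≡ successor-irrelevant IsOddParts-irrelevant (map-∸-+ 4 l))
  unfold-fold (inj₂ (inj₂ (inj₁ ((_ , e) , [] , v)))) =
    cong (inj₂ ∘ inj₂ ∘ inj₁) (⨁-≡ successor-irrelevant IsOddParts-irrelevant refl)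
  unfold-fold (inj₂ (inj₂ (inj₁ ((_ , e) , 0 ∷ l , (_ , () ∷ _) , _))))
  unfold-fold (inj₂ (inj₂ (inj₁ ((_ , e) , suc y ∷ l , v)))) =
    cong (inj₂ ∘ inj₂ ∘ inj₁) (⨁-≡ successor-irrelevant IsOddParts-irrelevant (cong (suc y ∷_) (map-∸-+ 4 l)))
  unfold-fold (inj₂ (inj₂ (inj₂ (0<p , [] , v)))) with () ← subst (0 <_) (sym (IsOddParts-length v)) 0<p
  unfold-fold (inj₂ (inj₂ (inj₂ (_ , 0 ∷ l , (_ , () ∷ _) , _))))
  unfold-fold (inj₂ (inj₂ (inj₂ (_ , suc x ∷ l , v)))) =
    cong (inj₂ ∘ inj₂ ∘ inj₂) (⨁-≡ <-irrelevant IsOddParts-irrelevant (cong (suc x ∷_) (map-∸-+ 2 l)))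

OddParts-unfold : ∀ i j → OddParts i j ≅ Unfold OddParts i j
OddParts-unfold i j = ≅-sym (mk≅ (mk↔ₛ′ fold unfold fold-unfold unfold-fold) fold-size)
  where open OddPartsUnfolding {i} {j}

T-isDoᵇ : ∀ l → T (isDoᵇ l) ⇔ OddDistinct l
T-isDoᵇ l = mk⇔
  (λ t → let inc-odd = proj₂ (Equivalence.to (T-∧ {isPartitionᵇ l}) t)
             inc , odd = Equivalence.to (T-∧ {incᵇ l}) inc-odd
         in Equivalence.to (T-incᵇ l) inc , Equivalence.to (T-allᵇ oddᵇ l) odd)
  (λ (lk , od) → Equivalence.from T-∧
    (Equivalence.from T-∧ (Equivalence.from (T-allᵇ _ l) (All.map (λ {x} → odd⇒pos {x}) od) ,
                           Equivalence.from (T-nondecᵇ l) (Linked.map <⇒≤ lk)) ,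
     Equivalence.from T-∧ (Equivalence.from (T-incᵇ l) lk , Equivalence.from (T-allᵇ oddᵇ l) od)))
  where
  odd⇒pos : ∀ {x} → T (oddᵇ x) → T (1 ≤ᵇ x)
  odd⇒pos {suc x} _ = tt

𝒟ᵒG : ℕ → ℕ → Graded
𝒟ᵒG i j = graded 𝒟ᵒ[ i , j ] (sum ∘ proj₁)

OddParts≅𝒟ᵒ : ∀ i j → OddParts i j ≅ 𝒟ᵒG i j
OddParts≅𝒟ᵒ i j = mk≅ (mk↔ₛ′ t f t∘f f∘t) (λ _ → refl)
  where
  t : Carrier (OddParts i j) → 𝒟ᵒ[ i , j ]
  t (l , od , eᵢ , eⱼ) = l , Equivalence.from (T-isDoᵇ l) od , IsOddParts-length (od , eᵢ , eⱼ) ,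
                         trans (sol2≡oddRuns l) eᵢ
  f : 𝒟ᵒ[ i , j ] → Carrier (OddParts i j)
  f (l , d , len , s) = l , Equivalence.to (T-isDoᵇ l) d , eᵢ ,
    *-cancelˡ-≡ _ _ 2 (+-cancelˡ-≡ i _ _ (trans (cong (_+ 2 * runPairs l) (sym eᵢ))
                                             (trans (sym (length≡oddRuns+2runPairs l)) len)))
    where eᵢ = trans (sym (sol2≡oddRuns l)) s
  t∘f : ∀ x → t (f x) ≡ x
  t∘f _ = Σ-≡-irrelevant (×-irrelevant T-irrelevant (×-irrelevant ≡-irrelevant ≡-irrelevant)) refl
  f∘t : ∀ x → f (t x) ≡ x
  f∘t _ = Σ-≡-irrelevant IsOddParts-irrelevant refl


-- The base partition

map-upTo-suc : ∀ (h : ℕ → ℕ) n → map h (upTo (suc n)) ≡ h 0 ∷ map (h ∘ suc) (upTo n)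
map-upTo-suc h n = cong (h 0 ∷_) (trans (map-applyUpTo suc h n) (sym (map-applyUpTo id (h ∘ suc) n)))

β-suc-0 : ∀ i → β (suc i) 0 ≡ 1 ∷ map (4 +_) (β i 0)
β-suc-0 i = begin
  map g (upTo (suc i))            ≡⟨ map-upTo-suc g i ⟩
  1 ∷ map (g ∘ suc) (upTo i)      ≡⟨ cong (1 ∷_) (trans (map-cong lemma (upTo i)) (map-∘ (upTo i))) ⟩
  1 ∷ map (4 +_) (map g (upTo i)) ∎
  where
  open ≡-Reasoning
  g : ℕ → ℕ
  g t = 4 * 0 + 1 + 4 * t
  lemma : ∀ t → 4 * 0 + 1 + 4 * suc t ≡ 4 + (4 * 0 + 1 + 4 * t)
  lemma = solve-∀

β-sucʳ : ∀ i j → β i (suc j) ≡ 1 ∷ 3 ∷ map (4 +_) (β i j)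
β-sucʳ i j = begin
  map h (upTo (2 * suc j)) ++ map g′ (upTo i)
    ≡⟨ cong₂ _++_ odds (trans (map-cong (g-suc j) (upTo i)) (map-∘ (upTo i))) ⟩
  (1 ∷ 3 ∷ map (4 +_) (map h (upTo (2 * j)))) ++ map (4 +_) (map g (upTo i))
    ≡⟨ cong (λ l → 1 ∷ 3 ∷ l) (map-++ (4 +_) (map h (upTo (2 * j))) (map g (upTo i))) ⟨
  1 ∷ 3 ∷ map (4 +_) (map h (upTo (2 * j)) ++ map g (upTo i)) ∎
  where
  open ≡-Reasoning
  h g g′ : ℕ → ℕ
  h t = 2 * t + 1
  g t = 4 * j + 1 + 4 * t
  g′ t = 4 * suc j + 1 + 4 * t
  h-suc-suc : ∀ t → 2 * suc (suc t) + 1 ≡ 4 + (2 * t + 1)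
  h-suc-suc = solve-∀
  g-suc : ∀ j t → 4 * suc j + 1 + 4 * t ≡ 4 + (4 * j + 1 + 4 * t)
  g-suc = solve-∀
  odds : map h (upTo (2 * suc j)) ≡ 1 ∷ 3 ∷ map (4 +_) (map h (upTo (2 * j)))
  odds = begin
    map h (upTo (2 * suc j))                        ≡⟨ cong (map h ∘ upTo) (*-suc 2 j) ⟩
    map h (upTo (2 + 2 * j))                        ≡⟨ map-upTo-suc h (suc (2 * j)) ⟩
    1 ∷ map (h ∘ suc) (upTo (suc (2 * j)))          ≡⟨ cong (1 ∷_) (map-upTo-suc (h ∘ suc) (2 * j)) ⟩
    1 ∷ 3 ∷ map (h ∘ suc ∘ suc) (upTo (2 * j))      ≡⟨ cong (λ l → 1 ∷ 3 ∷ l) (trans (map-cong h-suc-suc _)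
                                                                                (map-∘ _)) ⟩
    1 ∷ 3 ∷ map (4 +_) (map h (upTo (2 * j)))       ∎

β∈OddParts : ∀ i j → IsOddParts i j (β i j)
β∈OddParts zero    zero    = ([] , []) , refl , refl
β∈OddParts (suc i) zero    =
  subst (IsOddParts (suc i) 0) (sym (β-suc-0 i)) (IsOddParts-single refl (β∈OddParts i 0))
β∈OddParts i       (suc j) =
  subst (IsOddParts i (suc j)) (sym (β-sucʳ i j)) (IsOddParts-pair refl (β∈OddParts i j))

sum-β-suc-0 : ∀ i → sum (β (suc i) 0) ≡ suc (4 * parts i 0) + sum (β i 0)
sum-β-suc-0 i = trans (cong sum (β-suc-0 i))
  (trans (sum-single (β i 0)) (cong (λ n → suc (4 * n) + sum (β i 0)) (IsOddParts-length (β∈OddParts i 0))))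

sum-β-sucʳ : ∀ i j → sum (β i (suc j)) ≡ 4 + 4 * parts i j + sum (β i j)
sum-β-sucʳ i j = trans (cong sum (β-sucʳ i j))
  (trans (sum-pair (β i j)) (cong (λ n → 4 + 4 * n + sum (β i j)) (IsOddParts-length (β∈OddParts i j))))

sum-β : ∀ i j → sum (β i j) + i ≡ 2 * i * i + 4 * j * j + 4 * i * j
sum-β zero    zero    = refl
sum-β (suc i) zero    = begin
  sum (β (suc i) 0) + suc i                    ≡⟨ cong (_+ suc i) (sum-β-suc-0 i) ⟩
  suc (4 * (i + 2 * 0)) + sum (β i 0) + suc i  ≡⟨ lemma i (sum (β i 0)) ⟩
  (sum (β i 0) + i) + (4 * i + 2)              ≡⟨ cong (_+ (4 * i + 2)) (sum-β i 0) ⟩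
  2 * i * i + 4 * 0 * 0 + 4 * i * 0 + (4 * i + 2) ≡⟨ lemma′ i ⟩
  2 * suc i * suc i + 4 * 0 * 0 + 4 * suc i * 0 ∎
  where
  open ≡-Reasoning
  lemma : ∀ i s → suc (4 * (i + 2 * 0)) + s + suc i ≡ (s + i) + (4 * i + 2)
  lemma = solve-∀
  lemma′ : ∀ i → 2 * i * i + 4 * 0 * 0 + 4 * i * 0 + (4 * i + 2) ≡
                 2 * suc i * suc i + 4 * 0 * 0 + 4 * suc i * 0
  lemma′ = solve-∀
sum-β i (suc j) = begin
  sum (β i (suc j)) + i                         ≡⟨ cong (_+ i) (sum-β-sucʳ i j) ⟩
  4 + 4 * (i + 2 * j) + sum (β i j) + i         ≡⟨ lemma i j (sum (β i j)) ⟩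
  (sum (β i j) + i) + (4 + 4 * i + 8 * j)       ≡⟨ cong (_+ (4 + 4 * i + 8 * j)) (sum-β i j) ⟩
  2 * i * i + 4 * j * j + 4 * i * j + (4 + 4 * i + 8 * j) ≡⟨ lemma′ i j ⟩
  2 * i * i + 4 * suc j * suc j + 4 * i * suc j ∎
  where
  open ≡-Reasoning
  lemma : ∀ i j s → 4 + 4 * (i + 2 * j) + s + i ≡ (s + i) + (4 + 4 * i + 8 * j)
  lemma = solve-∀
  lemma′ : ∀ i j → 2 * i * i + 4 * j * j + 4 * i * j + (4 + 4 * i + 8 * j) ≡
                   2 * i * i + 4 * suc j * suc j + 4 * i * suc j
  lemma′ = solve-∀

sum-β-sucˡ : ∀ i j → 4 * j + sum (β (suc i) j) ≡ suc (4 * parts i j) + sum (β i j)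
sum-β-sucˡ i j = +-cancelʳ-≡ (suc i) _ _ (begin
  4 * j + sum (β (suc i) j) + suc i                        ≡⟨ +-assoc (4 * j) _ (suc i) ⟩
  4 * j + (sum (β (suc i) j) + suc i)                      ≡⟨ cong (4 * j +_) (sum-β (suc i) j) ⟩
  4 * j + (2 * suc i * suc i + 4 * j * j + 4 * suc i * j)  ≡⟨ lemma i j ⟩
  (2 + 4 * i + 8 * j) + (2 * i * i + 4 * j * j + 4 * i * j) ≡⟨ cong ((2 + 4 * i + 8 * j) +_) (sum-β i j) ⟨
  (2 + 4 * i + 8 * j) + (sum (β i j) + i)                  ≡⟨ lemma′ i j (sum (β i j)) ⟩
  suc (4 * (i + 2 * j)) + sum (β i j) + suc i              ∎)
  where
  open ≡-Reasoning
  lemma : ∀ i j → 4 * j + (2 * suc i * suc i + 4 * j * j + 4 * suc i * j) ≡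
                  (2 + 4 * i + 8 * j) + (2 * i * i + 4 * j * j + 4 * i * j)
  lemma = solve-∀
  lemma′ : ∀ i j s → (2 + 4 * i + 8 * j) + (s + i) ≡ suc (4 * (i + 2 * j)) + s + suc i
  lemma′ = solve-∀

β-length : ∀ i j → length (β i j) ≡ i + 2 * j
β-length i j = IsOddParts-length (β∈OddParts i j)

β-sol2 : ∀ i j → sol2 (β i j) ≡ i
β-sol2 i j = trans (sol2≡oddRuns (β i j)) (proj₁ (proj₂ (β∈OddParts i j)))


-- The product side

Term : ℕ → ℕ → Graded
Term i j = raise (sum (β i j)) (ℰG 2 i ⊗ ℰG 4 j)

Term-unfold : ∀ i j → Term i j ≅ Unfold Term i j
Term-unfold zero zero = begin
  raise 0 (ℰG 2 0 ⊗ ℰG 4 0)  ≈⟨ ⊗-cong (ℰ≅Tuples 2 0) (ℰ≅Tuples 4 0) ⟩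
  Tuples 2 0 ⊗ Tuples 4 0    ≈⟨ ⊗-cong (Tuples-zero 2) (Tuples-zero 4) ⟩
  𝟙 ⊗ 𝟙                      ≈⟨ ⊗-identityʳ ⟩
  𝟙                          ≈⟨ Unfold-0-0 Term ⟨
  Unfold Term 0 0            ∎
  where open ≅-Reasoning
Term-unfold (suc i) zero = begin
  raise b (ℰG 2 (suc i) ⊗ ℰG 4 0)     ≈⟨ ⊗-splitˡ (2 * suc i) b (ℰ-split 2 i) ⟩
  raise b (ℰG 2 i ⊗ ℰG 4 0) ⊕ raise (2 * suc i + b) (ℰG 2 (suc i) ⊗ ℰG 4 0)
    ≈⟨ ⊕-cong (raise-split (suc (4 * parts i 0)) (sum (β i 0)) (sum-β-sucˡ i 0))
              (raise-split (2 * parts (suc i) 0) b (lemma i b)) ⟩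
  raise (suc (4 * parts i 0)) (Term i 0) ⊕ raise (2 * parts (suc i) 0) (Term (suc i) 0)
    ≈⟨ Unfold-suc-0 Term i ⟨
  Unfold Term (suc i) 0 ∎
  where
  open ≅-Reasoning
  b = sum (β (suc i) 0)
  lemma : ∀ i b → 2 * suc i + b ≡ 2 * (suc i + 2 * 0) + b
  lemma = solve-∀
Term-unfold zero (suc j) = begin
  raise b (ℰG 2 0 ⊗ ℰG 4 (suc j))     ≈⟨ ⊗-splitʳ (4 * suc j) b (ℰ-split 4 j) ⟩
  raise b (ℰG 2 0 ⊗ ℰG 4 j) ⊕ raise (4 * suc j + b) (ℰG 2 0 ⊗ ℰG 4 (suc j))
    ≈⟨ ⊕-cong (raise-split (4 + 4 * parts 0 j) (sum (β 0 j)) (sum-β-sucʳ 0 j))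
              (raise-split (2 * parts 0 (suc j)) b (lemma j b)) ⟩
  raise (4 + 4 * parts 0 j) (Term 0 j) ⊕ raise (2 * parts 0 (suc j)) (Term 0 (suc j))
    ≈⟨ Unfold-0-suc Term j ⟨
  Unfold Term 0 (suc j) ∎
  where
  open ≅-Reasoning
  b = sum (β 0 (suc j))
  lemma : ∀ j b → 4 * suc j + b ≡ 2 * (0 + 2 * suc j) + b
  lemma = solve-∀
Term-unfold (suc i) (suc j) = begin
  raise b (ℰG 2 (suc i) ⊗ ℰG 4 (suc j))     ≈⟨ ⊗-splitʳ (4 * suc j) b (ℰ-split 4 j) ⟩
  raise b (ℰG 2 (suc i) ⊗ ℰG 4 j) ⊕ raise (4 * suc j + b) (ℰG 2 (suc i) ⊗ ℰG 4 (suc j))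
    ≈⟨ ⊕-cong ≅-refl (⊗-splitˡ (2 * suc i) (4 * suc j + b) (ℰ-split 2 i)) ⟩
  raise b (ℰG 2 (suc i) ⊗ ℰG 4 j) ⊕ raise (4 * suc j + b) (ℰG 2 i ⊗ ℰG 4 (suc j)) ⊕
    raise (2 * suc i + (4 * suc j + b)) (ℰG 2 (suc i) ⊗ ℰG 4 (suc j))
    ≈⟨ ⊕-cong (raise-split (4 + 4 * parts (suc i) j) (sum (β (suc i) j)) (sum-β-sucʳ (suc i) j))
         (⊕-cong (raise-split (suc (4 * parts i (suc j))) (sum (β i (suc j))) (sum-β-sucˡ i (suc j)))
                 (raise-split (2 * parts (suc i) (suc j)) b (lemma i j b))) ⟩
  raise (4 + 4 * parts (suc i) j) (Term (suc i) j) ⊕ raise (suc (4 * parts i (suc j))) (Term i (suc j)) ⊕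
    raise (2 * parts (suc i) (suc j)) (Term (suc i) (suc j))
    ≈⟨ Unfold-suc-suc Term i j ⟨
  Unfold Term (suc i) (suc j) ∎
  where
  open ≅-Reasoning
  b = sum (β (suc i) (suc j))
  lemma : ∀ i j b → 2 * suc i + (4 * suc j + b) ≡ 2 * (suc i + 2 * suc j) + b
  lemma = solve-∀

Term≅OddParts : ∀ i j → Term i j ≅ OddParts i j
Term≅OddParts i j = guarded-fixpoint-unique {F = λ A (i , j) → Unfold (curry A) i j}
  Unfold-guarded (uncurry Term-unfold) (uncurry OddParts-unfold) (i , j)

Term≅𝒟ᵒ : ∀ i j → Term i j ≅ 𝒟ᵒG i j
Term≅𝒟ᵒ i j = ≅-trans (Term≅OddParts i j) (OddParts≅𝒟ᵒ i j)

Term≅rhsTerm : ∀ i j → Term i j ≅ ofSeries (rhsTerm i j)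
Term≅rhsTerm i j = begin
  raise (sum (β i j)) (ℰG 2 i ⊗ ℰG 4 j)
    ≈⟨ raise-cong (sum (β i j)) (⊗-cong (ℰ≅invPoch 2 i) (ℰ≅invPoch 4 j)) ⟩
  raise (sum (β i j)) (ofSeries (invPoch 2 i) ⊗ ofSeries (invPoch 4 j))
    ≈⟨ raise-cong (sum (β i j)) (ofSeries-⊛ (invPoch 2 i) (invPoch 4 j)) ⟩
  raise (sum (β i j)) (ofSeries (invPoch 2 i ⊛ invPoch 4 j))
    ≈⟨ raise-≡ (trans (sym (m+n∸n≡m _ i)) (cong (_∸ i) (sum-β i j))) ⟩
  raise (2 * i * i + 4 * j * j + 4 * i * j ∸ i) (ofSeries (invPoch 2 i ⊛ invPoch 4 j))
    ≈⟨ ofSeries-shift _ _ ⟩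
  ofSeries (rhsTerm i j) ∎
  where open ≅-Reasoning


sumTo-zero : ∀ N f → (∀ t → t ≤ N → f t ≡ 0) → sumTo N f ≡ 0
sumTo-zero zero    f f≡0 = f≡0 0 z≤n
sumTo-zero (suc N) f f≡0 = cong₂ _+_ (sumTo-zero N f λ t t≤N → f≡0 t (m≤n⇒m≤1+n t≤N)) (f≡0 (suc N) ≤-refl)

sumTo-single : ∀ N f {t₀} → t₀ ≤ N → (∀ t → t ≢ t₀ → f t ≡ 0) → sumTo N f ≡ f t₀
sumTo-single zero    f z≤n f≡0 = refl
sumTo-single (suc N) f t₀≤ f≡0 with m≤n⇒m<n∨m≡n t₀≤
... | inj₁ (s≤s t₀≤N) =
  trans (cong₂ _+_ (sumTo-single N f t₀≤N f≡0) (f≡0 (suc N) λ { refl → <-irrefl refl t₀≤N })) (+-identityʳ _)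
... | inj₂ refl       = cong (_+ f (suc N)) (sumTo-zero N f λ t t≤N → f≡0 t λ { refl → <-irrefl refl t≤N })

rhsSummand : ℕ → ℕ → ℕ → ℕ → ℕ → ℕ
rhsSummand a b n i j = if (i ≡ᵇ a) ∧ (i + 2 * j ≡ᵇ b) then rhsTerm i j n else 0

rhsSummand-off : ∀ a b n i j → ¬ (i ≡ a × i + 2 * j ≡ b) → rhsSummand a b n i j ≡ 0
rhsSummand-off a b n i j ¬on with i ≡ᵇ a in eᵢ | i + 2 * j ≡ᵇ b in eⱼ
... | false | _     = refl
... | true  | false = refl
... | true  | true  = ⊥-elim (¬on (≡ᵇ⇒≡ i a (subst T (sym eᵢ) tt) , ≡ᵇ⇒≡ (i + 2 * j) b (subst T (sym eⱼ) tt)))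

rhsSummand-on : ∀ a j n → rhsSummand a (a + 2 * j) n a j ≡ rhsTerm a j n
rhsSummand-on a j n with a ≡ᵇ a in eᵢ | a + 2 * j ≡ᵇ a + 2 * j in eⱼ
... | true  | true  = refl
... | false | _     = ⊥-elim (subst T eᵢ (≡⇒≡ᵇ a a refl))
... | true  | false = ⊥-elim (subst T eⱼ (≡⇒≡ᵇ (a + 2 * j) (a + 2 * j) refl))

rhsCoeff-single : ∀ a j n → rhsCoeff a (a + 2 * j) n ≡ rhsTerm a j n
rhsCoeff-single a j n = begin
  sumTo b (λ i → sumTo b (rhsSummand a b n i))
    ≡⟨ sumTo-single b (λ i → sumTo b (rhsSummand a b n i)) (m≤m+n a (2 * j)) (λ i i≢a →
         sumTo-zero b (rhsSummand a b n i) λ j′ _ → rhsSummand-off a b n i j′ (i≢a ∘ proj₁)) ⟩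
  sumTo b (rhsSummand a b n a)
    ≡⟨ sumTo-single b (rhsSummand a b n a) j≤b (λ j′ j′≢j →
         rhsSummand-off a b n a j′ λ (_ , e) → j′≢j (*-cancelˡ-≡ j′ j 2 (+-cancelˡ-≡ a _ _ e))) ⟩
  rhsSummand a b n a j
    ≡⟨ rhsSummand-on a j n ⟩
  rhsTerm a j n ∎
  where
  open ≡-Reasoning
  b = a + 2 * j
  j≤b : j ≤ b
  j≤b = ≤-trans (m≤m+n j (j + 0)) (m≤n+m (2 * j) a)

rhsCoeff-none : ∀ a b n → (∀ j → b ≢ a + 2 * j) → rhsCoeff a b n ≡ 0
rhsCoeff-none a b n none =
  sumTo-zero b (λ i → sumTo b (rhsSummand a b n i)) λ i _ →
  sumTo-zero b (rhsSummand a b n i) λ j _ →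
  rhsSummand-off a b n i j λ (eᵢ , eⱼ) → none j (trans (sym eⱼ) (cong (_+ 2 * j) eᵢ))

even-gap? : ∀ a b → (Σ ℕ λ j → b ≡ a + 2 * j) ⊎ (∀ j → b ≢ a + 2 * j)
even-gap? a b with a ≤? b | 2 ∣? (b ∸ a)
... | no a≰b  | _                = inj₂ λ j e → a≰b (subst (a ≤_) (sym e) (m≤m+n a (2 * j)))
... | yes a≤b | yes (divides q e) = inj₁ (q , trans (sym (m+[n∸m]≡n a≤b)) (cong (a +_) (trans e (*-comm q 2))))
... | yes a≤b | no ¬2∣           = inj₂ λ j e →
  ¬2∣ (divides j (trans (cong (_∸ a) e) (trans (m+n∸m≡n a (2 * j)) (*-comm 2 j))))

Fiber : ℕ → ℕ → ℕ → Set
Fiber a b n = Σ (List ℕ) (λ lam → T (isDoᵇ lam) × (sol2 lam ≡ a) × (length lam ≡ b) × (sum lam ≡ n))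

Fiber-empty : ∀ a b n → (∀ j → b ≢ a + 2 * j) → ¬ Fiber a b n
Fiber-empty a b n none (l , _ , s , len , _) = none (runPairs l) (begin
  b                             ≡⟨ len ⟨
  length l                      ≡⟨ length≡oddRuns+2runPairs l ⟩
  oddRuns l + 2 * runPairs l    ≡⟨ cong (_+ 2 * runPairs l) (trans (sym (sol2≡oddRuns l)) s) ⟩
  a + 2 * runPairs l            ∎)
  where open ≡-Reasoning

Fiber↔Fib𝒟ᵒ : ∀ a j n → Fiber a (a + 2 * j) n ↔ Fib (𝒟ᵒG a j) n
Fiber↔Fib𝒟ᵒ a j n = mk↔ₛ′ (λ (l , d , s , len , e) → (l , d , len , s) , e)
                          (λ ((l , d , len , s) , e) → l , d , s , len , e) (λ _ → refl) (λ _ → refl)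

Fiber-count : ∀ a b n → Fiber a b n ↔ Fin (rhsCoeff a b n)
Fiber-count a b n with even-gap? a b
... | inj₁ (j , refl) = begin
  Fiber a (a + 2 * j) n            ↔⟨ Fiber↔Fib𝒟ᵒ a j n ⟩
  Fib (𝒟ᵒG a j) n                  ↔⟨ Fib-cong (≅-trans (≅-sym (Term≅𝒟ᵒ a j)) (Term≅rhsTerm a j)) n ⟩
  Fib (ofSeries (rhsTerm a j)) n   ↔⟨ Fib-ofSeries (rhsTerm a j) n ⟩
  Fin (rhsTerm a j n)              ≡⟨ cong Fin (rhsCoeff-single a j n) ⟨
  Fin (rhsCoeff a (a + 2 * j) n)   ∎
  where open EquationalReasoning
... | inj₂ none = subst (λ c → Fiber a b n ↔ Fin c) (sym (rhsCoeff-none a b n none))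
  (mk↔ₛ′ (⊥-elim ∘ Fiber-empty a b n none) (λ ()) (λ ()) (⊥-elim ∘ Fiber-empty a b n none))


Triples : ℕ → ℕ → Graded
Triples i j = graded ((Σ (List ℕ) (λ b → b ≡ β i j)) × ℰ[ 2 , i ] × ℰ[ 4 , j ])
  (λ ((b , _) , (mu , _) , (eta , _)) → sum b + sum mu + sum eta)

𝒟ᵒ-preserves-β : ∀ {i j} (x : Carrier (Triples i j)) (lam : 𝒟ᵒ[ i , j ]) →
  length (proj₁ lam) ≡ length (proj₁ (proj₁ x)) × sol2 (proj₁ lam) ≡ sol2 (proj₁ (proj₁ x))
𝒟ᵒ-preserves-β {i} {j} ((_ , refl) , _) (_ , _ , len , s) =
  trans len (sym (β-length i j)) , trans s (sym (β-sol2 i j))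

Triples≅Term : ∀ i j → Triples i j ≅ Term i j
Triples≅Term i j = mk≅ (mk↔ₛ′ proj₂ ((β i j , refl) ,_) (λ _ → refl) λ { ((_ , refl) , _) → refl })
  λ { ((b , refl) , (mu , _) , (eta , _)) → sym (+-assoc (sum b) (sum mu) (sum eta)) }

theorem2p1 : ((i j : ℕ) →
      Σ (((Σ (List ℕ) (λ b → b ≡ β i j)) × ℰ[ 2 , i ] × ℰ[ 4 , j ]) ↔ 𝒟ᵒ[ i , j ]) (λ α →
        (x : (Σ (List ℕ) (λ b → b ≡ β i j)) × ℰ[ 2 , i ] × ℰ[ 4 , j ]) →
          let lam = proj₁ (Inverse.to α x)
              b = proj₁ (proj₁ x)
              mu = proj₁ (proj₁ (proj₂ x))
              eta = proj₁ (proj₂ (proj₂ x))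
          in (sum lam ≡ sum b + sum mu + sum eta)
             × (length lam ≡ length b)
             × (sol2 lam ≡ sol2 b)))
    × ((a b n : ℕ) →
      Σ (List ℕ) (λ lam → T (isDoᵇ lam) × (sol2 lam ≡ a) × (length lam ≡ b) × (sum lam ≡ n))
        ↔ Fin (rhsCoeff a b n))
theorem2p1 =
  (λ i j → bijection (α i j) , λ x → size-to (α i j) x , 𝒟ᵒ-preserves-β x (to (bijection (α i j)) x)) ,
  Fiber-count
  where
  α : ∀ i j → Triples i j ≅ 𝒟ᵒG i j
  α i j = ≅-trans (Triples≅Term i j) (Term≅𝒟ᵒ i j)
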